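{- Let $G$ be a bipartite finite simple graph. For each connected component of $G$, with bipartition into parts of sizes $k_i\le \ell_i$, let $d_i=\ell_i-k_i$. Then the multiset of nonzero values $d_i$ (over all connected components) is determined by $X_G^G$; that is, if $G'$ is another bipartite finite simple graph with $X_{G'}^{G'}=X_G^G$, then the multisets of nonzero differences $d_i$ for $G$ and for $G'$ coincide.
   Context: All graphs are finite and simple. A graph homomorphism $f:G\to H$ is a map $f:V(G)\to V(H)$ such that $uv\in E(G)$ implies $f(u)f(v)\in E(H)$. The type of $f$ is the integer partition whose parts are the nonzero sizes $|f^{ -1}(w)|$, $w\in V(H)$. For a partition $\lambda$ with $r_i(\lambda)$ parts equal to $i$ and length $\ell(\lambda)\le N$, set $m_\lambda^N=\frac{N!}{\binom{N}{r_1(\lambda),r_2(\lambda),\dots,N-\ell(\lambda)}}m_\lambda$, where $m_\lambda$ is the monomial symmetric function. The $H$-chromatic symmetric function is $X_G^H=\sum_\lambda d_\lambda m_\lambda^{|V(H)|}$, where $d_\lambda$ is the number of homomorphisms $G\to H$ of type $\lambda$. The self-chromatic symmetric function of $G$ is $X_G^G$. An isolated vertex is a component with parts of sizes $0$ and $1$. -}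

module Defs where

open import Data.Bool using (Bool; true; false; _∧_; _∨_; not; if_then_else_)
open import Data.Nat using (ℕ; zero; suc; _≤_; _<_; _≤?_; _<?_; _*_; ∣_-_∣; _∸_; _!)
open import Data.Nat.Properties using (≤-decTotalOrder)
import Data.Nat.Properties as ℕP
open import Data.Nat.ListAction using (product; sum)
open import Data.Bool.ListAction using (all; any)
open import Data.Fin using (Fin; toℕ)
import Data.Fin.Properties as FinP
open import Data.List using (List; []; _∷_; map; filter; length; upTo; concatMap; allFin; filterᵇ)
open import Data.List.Properties using (≡-dec)
open import Data.List.Relation.Unary.All using (All)
open import Data.List.Relation.Unary.Linked using (Linked)
open import Data.List.Relation.Binary.Permutation.Propositional using (_↭_)
open import Data.List.Sort ≤-decTotalOrder using (sort)
open import Data.Vec.Functional using (Vector) renaming (_∷_ to _∷ᶠ_)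
open import Data.Product using (Σ; _×_; _,_)
open import Data.Empty using (⊥)
open import Relation.Binary.PropositionalEquality using (_≡_)
open import Relation.Nullary using (does)

record Graph : Set where
  field
    n      : ℕ
    adj    : Fin n → Fin n → Bool
    sym    : ∀ u v → adj u v ≡ adj v u
    irrefl : ∀ u → adj u u ≡ false
open Graph public

allMaps : (a b : ℕ) → List (Fin a → Fin b)
allMaps zero    b = (λ ()) ∷ []
allMaps (suc a) b = concatMap (λ f → map (λ x → x ∷ᶠ f) (allFin b)) (allMaps a b)

isHom : (G H : Graph) → (Fin (n G) → Fin (n H)) → Bool
isHom G H f = all (λ u → all (λ v → not (adj G u v) ∨ adj H (f u) (f v)) (allFin (n G))) (allFin (n G))

fiberSize : {a b : ℕ} → (Fin a → Fin b) → Fin b → ℕ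
fiberSize {a} f w = length (filter (λ u → f u FinP.≟ w) (allFin a))

IsPartition : List ℕ → Set
IsPartition λ′ = Linked _≤_ λ′ × All (0 <_) λ′

homType : {a b : ℕ} → (Fin a → Fin b) → List ℕ
homType {a} {b} f = sort (filter (λ k → 0 <? k) (map (fiberSize f) (allFin b)))

homCount : (G H : Graph) → List ℕ → ℕ
homCount G H λ′ =
  length (filterᵇ (λ f → isHom G H f ∧ does (≡-dec ℕP._≟_ (homType f) λ′))
                 (allMaps (n G) (n H)))

mult : List ℕ → ℕ → ℕ
mult λ′ i = length (filter (λ k → k ℕP.≟ i) λ′)

-- N! / binom(N; r_1, r_2, …, N - ℓ(λ)) = r_1! r_2! ⋯ (N - ℓ(λ))!
mScale : ℕ → List ℕ → ℕ
mScale N λ′ = product (map (λ i → (mult λ′ (suc i)) !) (upTo (sum λ′))) * ((N ∸ length λ′) !)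

-- Coefficient of the monomial symmetric function m_λ in X_G^H
-- (m_λ^N with ℓ(λ) > N does not occur in the sum, coefficient 0).
XCoeff : (G H : Graph) → List ℕ → ℕ
XCoeff G H λ′ = if does (length λ′ ≤? n H) then homCount G H λ′ * mScale (n H) λ′ else 0

-- Equality of the self-chromatic symmetric functions X_G^G = X_{G'}^{G'},
-- i.e. equality of all coefficients in the monomial basis {m_λ}.
SameSelfChromatic : Graph → Graph → Set
SameSelfChromatic G G′ = ∀ λ′ → IsPartition λ′ → XCoeff G G λ′ ≡ XCoeff G′ G′ λ′

ProperColouring : Graph → Set
ProperColouring G = Σ (Fin (n G) → Bool) λ c → ∀ u v → adj G u v ≡ true → (c u ≡ c v → ⊥)

Bipartite : Graph → Set
Bipartite = ProperColouring

reachK : (G : Graph) → ℕ → Fin (n G) → Fin (n G) → Bool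
reachK G zero    u v = does (u FinP.≟ v)
reachK G (suc k) u v = reachK G k u v ∨ any (λ w → reachK G k u w ∧ adj G w v) (allFin (n G))

-- u and v lie in the same connected component (walks of length ≤ |V| suffice)
connected : (G : Graph) → Fin (n G) → Fin (n G) → Bool
connected G = reachK G (n G)

isRep : (G : Graph) → Fin (n G) → Bool
isRep G v = not (any (λ u → does (toℕ u <? toℕ v) ∧ connected G u v) (allFin (n G)))

compDiff : (G : Graph) → Bipartite G → Fin (n G) → ℕ
compDiff G (c , _) v =
  ∣ length (filterᵇ (λ u → connected G v u ∧ c u) (allFin (n G)))
  - length (filterᵇ (λ u → connected G v u ∧ not (c u)) (allFin (n G))) ∣

-- the multiset (as a list, compared up to permutation) of nonzero d_i over all components
nonzeroDiffs : (G : Graph) → Bipartite G → List ℕ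
nonzeroDiffs G b =
  filter (λ d → 0 <? d) (map (compDiff G b) (filterᵇ (isRep G) (allFin (n G))))

module Submission where

-- A homomorphism G → G whose type has two parts a ≤ c maps G onto an edge pq, so it amounts to an
-- arc (p, q) together with a proper 2-colouring of G. Hence X_G^G determines E · W a for 0 < a ≤ |V|/2,
-- where E is the number of arcs and W s the number of proper colourings with s vertices of colour 0;
-- as W is palindromic and W 0 = 0 (G has an edge), it determines E · W. A proper colouring chooses,
-- independently in each component with sides k ≤ ℓ, the side of colour 0, so the generating function
-- of W is x ^ K ∏ (1 + x ^ (ℓ - k)) with K = ∑ k. Its lowest term fixes K and E · 2 ^ (number of
-- d = 0), leaving ∏ (1 + x ^ d) over the nonzero differences d. The least positive exponent of such a
-- product is its least d, whose factor can be cancelled, so the nonzero d are recovered one by one.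
-- Edgeless graphs, where every d is 1, are recognised by the coefficient of m_(|V|), which counts
-- constant endomorphisms.

open import Data.Bool using (Bool; true; false; _∧_; _∨_; not; if_then_else_)
import Data.Bool.Properties as Boolₚ
open import Data.Bool.ListAction using (and; all; any)
open import Data.Empty using (⊥; ⊥-elim)
open import Data.Fin using (Fin; zero; suc; toℕ)
import Data.Fin.Properties as Finₚ
open import Data.List using (List; []; _∷_; map; filter; filterᵇ; length; allFin; tabulate; concatMap; _++_; upTo)
open import Data.List.Properties using (map-tabulate; map-∘; length-tabulate; ≡-dec; tabulate-cong; filter-accept; filter-reject; filter-all)
import Data.List.Properties as Listₚ
open import Data.List.Relation.Binary.Permutation.Propositional as ↭
  using (_↭_; ↭-refl; ↭-trans; ↭-sym; ↭-swap; ↭-reflexive; ↭⇒↭ₛ)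
open import Data.List.Relation.Binary.Permutation.Propositional.Properties using (All-resp-↭; ∈-resp-↭; ↭-length)
open import Data.List.Relation.Binary.Pointwise using (Pointwise-≡⇒≡)
open import Data.List.Relation.Unary.All using (All; []; _∷_)
open import Data.List.Relation.Unary.All.Properties using (tabulate⁺)
open import Data.List.Relation.Unary.Any using (here; there)
open import Data.List.Relation.Unary.Linked as Linked using (Linked; [-]; _∷_)
open import Data.List.Relation.Unary.Linked.Properties using (Linked⇒All)
open import Data.List.Relation.Unary.Sorted.TotalOrder.Properties using (↗↭↗⇒≋)
open import Data.Nat using (ℕ; zero; suc; _+_; _*_; _∸_; _^_; _⊓_; ∣_-_∣; _≤_; _<_; _≤?_; _<?_; z≤n; s≤s; z<s; _!; NonZero; ≢-nonZero⁻¹; >-nonZero)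
open import Data.Nat.ListAction using (sum)
open import Data.Nat.ListAction.Properties using (sum-↭; product≢0)
open import Data.Nat.Properties
open import Data.Product using (∃-syntax; _×_; _,_; proj₁; proj₂)
open import Data.Sum using (_⊎_; inj₁; inj₂; [_,_]′)
open import Data.Vec.Functional using () renaming (_∷_ to _∷ᶠ_)
open import Function using (_∘_; id; it; mk⇔)
open import Relation.Binary using (tri<; tri≈; tri>)
open import Relation.Binary.PropositionalEquality
open import Relation.Nullary using (¬_; Dec; yes; no; does; _because_; invert)
open import Relation.Nullary.Decidable using (dec-true; dec-false; does-⇔)

open import Defs hiding (sym)
open import Data.List.Sort ≤-decTotalOrder using (sort; sort-↭; sort-↗)

open import Algebra.Properties.CommutativeSemigroup +-commutativeSemigroup using (interchange)
open import Algebra.Properties.CommutativeSemigroup *-commutativeSemigroup using () renaming (x∙yz≈y∙xz to *-left-comm)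

open ≡-Reasoning

-- Finite sums and counting

χ : Bool → ℕ
χ true  = 1
χ false = 0

∑ : {A : Set} → List A → (A → ℕ) → ℕ
∑ []       h = 0
∑ (x ∷ xs) h = h x + ∑ xs h

∑Fin : (n : ℕ) → (Fin n → ℕ) → ℕ
∑Fin n = ∑ (allFin n)

∑Maps : (a b : ℕ) → ((Fin a → Fin b) → ℕ) → ℕ
∑Maps a b = ∑ (allMaps a b)

module _ {A : Set} where

  ∑-cong : (xs : List A) {h k : A → ℕ} → (∀ x → h x ≡ k x) → ∑ xs h ≡ ∑ xs k
  ∑-cong []       h≗k = refl
  ∑-cong (x ∷ xs) h≗k = cong₂ _+_ (h≗k x) (∑-cong xs h≗k)

  ∑-zero : (xs : List A) → ∑ xs (λ _ → 0) ≡ 0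
  ∑-zero []       = refl
  ∑-zero (x ∷ xs) = ∑-zero xs

  ∑-+ : (xs : List A) (h k : A → ℕ) → ∑ xs (λ x → h x + k x) ≡ ∑ xs h + ∑ xs k
  ∑-+ []       h k = refl
  ∑-+ (x ∷ xs) h k = begin
    h x + k x + ∑ xs (λ x → h x + k x) ≡⟨ cong (h x + k x +_) (∑-+ xs h k) ⟩
    h x + k x + (∑ xs h + ∑ xs k)       ≡⟨ interchange (h x) (k x) (∑ xs h) (∑ xs k) ⟩
    h x + ∑ xs h + (k x + ∑ xs k)       ∎

  ∑-*ˡ : (xs : List A) (c : ℕ) (h : A → ℕ) → ∑ xs (λ x → c * h x) ≡ c * ∑ xs h
  ∑-*ˡ []       c h = sym (*-zeroʳ c)
  ∑-*ˡ (x ∷ xs) c h = trans (cong (c * h x +_) (∑-*ˡ xs c h)) (sym (*-distribˡ-+ c (h x) (∑ xs h)))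

  ∑-*ʳ : (xs : List A) (c : ℕ) (h : A → ℕ) → ∑ xs (λ x → h x * c) ≡ ∑ xs h * c
  ∑-*ʳ xs c h = trans (∑-cong xs (λ x → *-comm (h x) c)) (trans (∑-*ˡ xs c h) (*-comm c _))

  ∑-++ : (xs ys : List A) (h : A → ℕ) → ∑ (xs ++ ys) h ≡ ∑ xs h + ∑ ys h
  ∑-++ []       ys h = refl
  ∑-++ (x ∷ xs) ys h = trans (cong (h x +_) (∑-++ xs ys h)) (sym (+-assoc (h x) _ _))

  ∑-mono : (xs : List A) {h k : A → ℕ} → (∀ x → h x ≤ k x) → ∑ xs h ≤ ∑ xs k
  ∑-mono []       h≤k = z≤n
  ∑-mono (x ∷ xs) h≤k = +-mono-≤ (h≤k x) (∑-mono xs h≤k)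

  ∑-χ-nonzero : (xs : List A) (P : A → Bool) → ∑ xs (χ ∘ P) ≢ 0 → ∃[ x ] P x ≡ true
  ∑-χ-nonzero []       P ∑≢0 = ⊥-elim (∑≢0 refl)
  ∑-χ-nonzero (x ∷ xs) P ∑≢0 with P x in Px
  ... | true  = x , Px
  ... | false = ∑-χ-nonzero xs P ∑≢0

  length-filter≡∑ : {P : A → Set} (P? : ∀ x → Dec (P x)) (xs : List A) →
                  length (filter P? xs) ≡ ∑ xs (χ ∘ does ∘ P?)
  length-filter≡∑ P? []       = refl
  length-filter≡∑ P? (x ∷ xs) with does (P? x)
  ... | true  = cong suc (length-filter≡∑ P? xs)
  ... | false = length-filter≡∑ P? xs

  length-filterᵇ : (P : A → Bool) (xs : List A) → length (filterᵇ P xs) ≡ ∑ xs (χ ∘ P)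
  length-filterᵇ P = length-filter≡∑ _

module _ {A B : Set} where

  ∑-map : (f : A → B) (xs : List A) (h : B → ℕ) → ∑ (map f xs) h ≡ ∑ xs (h ∘ f)
  ∑-map f []       h = refl
  ∑-map f (x ∷ xs) h = cong (h (f x) +_) (∑-map f xs h)

  ∑-concatMap : (f : A → List B) (xs : List A) (h : B → ℕ) →
                ∑ (concatMap f xs) h ≡ ∑ xs (λ x → ∑ (f x) h)
  ∑-concatMap f []       h = refl
  ∑-concatMap f (x ∷ xs) h =
    trans (∑-++ (f x) (concatMap f xs) h) (cong (∑ (f x) h +_) (∑-concatMap f xs h))

  ∑-swap : (xs : List A) (ys : List B) (k : A → B → ℕ) →
           ∑ xs (λ x → ∑ ys (k x)) ≡ ∑ ys (λ y → ∑ xs (λ x → k x y))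
  ∑-swap []       ys k = sym (∑-zero ys)
  ∑-swap (x ∷ xs) ys k = begin
    ∑ ys (k x) + ∑ xs (λ x → ∑ ys (k x))          ≡⟨ cong (∑ ys (k x) +_) (∑-swap xs ys k) ⟩
    ∑ ys (k x) + ∑ ys (λ y → ∑ xs (λ x → k x y))  ≡⟨ ∑-+ ys (k x) _ ⟨
    ∑ ys (λ y → k x y + ∑ xs (λ x → k x y))       ∎

∑-tabulate : {B : Set} (n : ℕ) (f : Fin n → B) (h : B → ℕ) → ∑ (tabulate f) h ≡ ∑Fin n (h ∘ f)
∑-tabulate zero    f h = refl
∑-tabulate (suc n) f h =
  cong (h (f zero) +_) (trans (∑-tabulate n (f ∘ suc) h) (sym (∑-tabulate n suc (h ∘ f))))

∑Fin-suc : (n : ℕ) (h : Fin (suc n) → ℕ) → ∑Fin (suc n) h ≡ h zero + ∑Fin n (h ∘ suc)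
∑Fin-suc n h = cong (h zero +_) (∑-tabulate n suc h)

∑Fin-const : (n c : ℕ) → ∑Fin n (λ _ → c) ≡ n * c
∑Fin-const zero    c = refl
∑Fin-const (suc n) c = trans (∑Fin-suc n _) (cong (c +_) (∑Fin-const n c))

∑Maps-suc : (a b : ℕ) (h : (Fin (suc a) → Fin b) → ℕ) →
            ∑Maps (suc a) b h ≡ ∑Maps a b (λ f → ∑Fin b (λ x → h (x ∷ᶠ f)))
∑Maps-suc a b h = trans (∑-concatMap _ (allMaps a b) h)
                        (∑-cong (allMaps a b) (λ f → ∑-map (λ x → x ∷ᶠ f) (allFin b) h))

χ-∧ : ∀ a b → χ (a ∧ b) ≡ χ a * χ b
χ-∧ true  b = sym (+-identityʳ (χ b))
χ-∧ false b = refl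

χ-≤1 : ∀ a → χ a ≤ 1
χ-≤1 true  = s≤s z≤n
χ-≤1 false = z≤n

χ-mono : ∀ {a b} → (a ≡ true → b ≡ true) → χ a ≤ χ b
χ-mono {false} a⇒b = z≤n
χ-mono {true}  a⇒b rewrite a⇒b refl = s≤s z≤n

χ-< : ∀ {a b} → (a ≡ true → b ≡ true) → a ≢ b → χ a < χ b
χ-< {false} {true}  _   _   = z<s
χ-< {false} {false} _   a≢b = ⊥-elim (a≢b refl)
χ-< {true}          a⇒b a≢b = ⊥-elim (a≢b (sym (a⇒b refl)))

false≢true : false ≢ true
false≢true ()

does-true⇒ : {A : Set} (d : Dec A) → does d ≡ true → A
does-true⇒ (true because [a]) _ = invert [a]

_==_ : {n : ℕ} → Fin n → Fin n → Bool
x == y = does (x Finₚ.≟ y)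

==-refl : ∀ {n} (x : Fin n) → (x == x) ≡ true
==-refl x = dec-true (x Finₚ.≟ x) refl

==-sym : ∀ {n} (x y : Fin n) → (x == y) ≡ (y == x)
==-sym x y = does-⇔ (mk⇔ sym sym) (x Finₚ.≟ y) (y Finₚ.≟ x)

==⇒≡ : ∀ {n} {x y : Fin n} → (x == y) ≡ true → x ≡ y
==⇒≡ {x = x} {y} = does-true⇒ (x Finₚ.≟ y)

≢⇒==false : ∀ {n} {x y : Fin n} → x ≢ y → (x == y) ≡ false
≢⇒==false {x = x} {y} = dec-false (x Finₚ.≟ y)

∑-χ-false : {A : Set} (xs : List A) {P : A → Bool} → (∀ x → P x ≡ false) → ∑ xs (χ ∘ P) ≡ 0
∑-χ-false xs P≡false = trans (∑-cong xs (cong χ ∘ P≡false)) (∑-zero xs)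

∑Fin-selectˡ : (n : ℕ) (p : Fin n) (h : Fin n → ℕ) → ∑Fin n (λ w → χ (w == p) * h w) ≡ h p
∑Fin-selectˡ (suc n) zero h = begin
  ∑Fin (suc n) (λ w → χ (w == zero) * h w) ≡⟨ ∑Fin-suc n _ ⟩
  h zero + 0 + ∑Fin n (λ _ → 0) ≡⟨ cong₂ _+_ (+-identityʳ (h zero)) (∑-zero (allFin n)) ⟩
  h zero + 0                     ≡⟨ +-identityʳ (h zero) ⟩
  h zero                         ∎
∑Fin-selectˡ (suc n) (suc p) h = trans (∑Fin-suc n (λ w → χ (w == suc p) * h w)) (∑Fin-selectˡ n p (h ∘ suc))

∑Fin-selectʳ : (n : ℕ) (p : Fin n) (h : Fin n → ℕ) → ∑Fin n (λ w → χ (p == w) * h w) ≡ h p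
∑Fin-selectʳ n p h =
  trans (∑-cong (allFin n) (λ w → cong (λ b → χ b * h w) (==-sym p w))) (∑Fin-selectˡ n p h)

∑Fin-χ== : (n : ℕ) (p : Fin n) → ∑Fin n (λ w → χ (p == w)) ≡ 1
∑Fin-χ== n p = trans (∑-cong (allFin n) (λ w → sym (*-identityʳ _))) (∑Fin-selectʳ n p (λ _ → 1))

∑Fin-term≤ : (n : ℕ) (h : Fin n → ℕ) (p : Fin n) → h p ≤ ∑Fin n h
∑Fin-term≤ n h p = subst (_≤ ∑Fin n h) (∑Fin-selectˡ n p h) (∑-mono (allFin n) term≤)
  where
  term≤ : ∀ w → χ (w == p) * h w ≤ h w
  term≤ w with w == p
  ... | true  = ≤-reflexive (+-identityʳ (h w))
  ... | false = z≤n

∑Fin-strict-mono : (n : ℕ) (h k : Fin n → ℕ) → (∀ x → h x ≤ k x) → (p : Fin n) → h p < k p →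
                   ∑Fin n h < ∑Fin n k
∑Fin-strict-mono n h k h≤k p hp<kp =
  subst (_≤ ∑Fin n k) ∑-bumped (∑-mono (allFin n) bumped≤k)
  where
  bumped≤k : ∀ x → h x + χ (x == p) ≤ k x
  bumped≤k x with x Finₚ.≟ p
  ... | yes refl = subst (_≤ k x) (+-comm 1 (h x)) hp<kp
  ... | no _     = subst (_≤ k x) (sym (+-identityʳ (h x))) (h≤k x)
  ∑-bumped : ∑Fin n (λ x → h x + χ (x == p)) ≡ suc (∑Fin n h)
  ∑-bumped = begin
    ∑Fin n (λ x → h x + χ (x == p))  ≡⟨ ∑-+ (allFin n) h _ ⟩
    ∑Fin n h + ∑Fin n (χ ∘ (_== p))   ≡⟨ cong (∑Fin n h +_) (trans (∑-cong (allFin n) (λ x → cong χ (==-sym x p))) (∑Fin-χ== n p)) ⟩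
    ∑Fin n h + 1                      ≡⟨ +-comm (∑Fin n h) 1 ⟩
    suc (∑Fin n h)                    ∎

_=ᶠ_ : {a b : ℕ} → (Fin a → Fin b) → (Fin a → Fin b) → Bool
_=ᶠ_ {zero}  f g = true
_=ᶠ_ {suc a} f g = (f zero == g zero) ∧ ((f ∘ suc) =ᶠ (g ∘ suc))

=ᶠ-sound : {a b : ℕ} (f g : Fin a → Fin b) → (f =ᶠ g) ≡ true → f ≗ g
=ᶠ-sound {suc a} f g f=g zero with f zero Finₚ.≟ g zero
... | yes f0≡g0 = f0≡g0
=ᶠ-sound {suc a} f g () zero | no _
=ᶠ-sound {suc a} f g f=g (suc i) with f zero == g zero
... | true = =ᶠ-sound (f ∘ suc) (g ∘ suc) f=g i

=ᶠ-complete : {a b : ℕ} (f g : Fin a → Fin b) → f ≗ g → (f =ᶠ g) ≡ true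
=ᶠ-complete {zero}  f g f≗g = refl
=ᶠ-complete {suc a} f g f≗g rewrite f≗g zero | ==-refl (g zero) =
  =ᶠ-complete (f ∘ suc) (g ∘ suc) (f≗g ∘ suc)

=ᶠ-sym : {a b : ℕ} (f g : Fin a → Fin b) → (f =ᶠ g) ≡ (g =ᶠ f)
=ᶠ-sym {zero}  f g = refl
=ᶠ-sym {suc a} f g = cong₂ _∧_ (==-sym (f zero) (g zero)) (=ᶠ-sym (f ∘ suc) (g ∘ suc))

∑Maps-singleton : (a b : ℕ) (z : Fin a → Fin b) → ∑Maps a b (λ f → χ (f =ᶠ z)) ≡ 1
∑Maps-singleton zero    b z = refl
∑Maps-singleton (suc a) b z = begin
  ∑Maps (suc a) b (λ f → χ (f =ᶠ z))
    ≡⟨ ∑Maps-suc a b _ ⟩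
  ∑Maps a b (λ f → ∑Fin b (λ x → χ ((x == z zero) ∧ (f =ᶠ (z ∘ suc)))))
    ≡⟨ ∑-cong (allMaps a b) (λ f → trans (∑-cong (allFin b) (λ x → χ-∧ (x == z zero) _))
                                          (∑Fin-selectˡ b (z zero) _)) ⟩
  ∑Maps a b (λ f → χ (f =ᶠ (z ∘ suc)))
    ≡⟨ ∑Maps-singleton a b (z ∘ suc) ⟩
  1 ∎

Respects≗ : {a b : ℕ} {C : Set} → ((Fin a → Fin b) → C) → Set
Respects≗ {a} {b} P = ∀ (f g : Fin a → Fin b) → f ≗ g → P f ≡ P g

module _ {a b c d : ℕ} {P : (Fin a → Fin b) → Bool} {Q : (Fin c → Fin d) → Bool}
         (P-resp : Respects≗ P) (Q-resp : Respects≗ Q)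
         (φ : (Fin a → Fin b) → (Fin c → Fin d)) (ψ : (Fin c → Fin d) → (Fin a → Fin b))
         (φ-resp : ∀ f g → f ≗ g → φ f ≗ φ g) (ψ-resp : ∀ f g → f ≗ g → ψ f ≗ ψ g)
         (φ-maps : ∀ f → P f ≡ true → Q (φ f) ≡ true) (ψ-maps : ∀ g → Q g ≡ true → P (ψ g) ≡ true)
         (ψ∘φ : ∀ f → P f ≡ true → ψ (φ f) ≗ f) (φ∘ψ : ∀ g → Q g ≡ true → φ (ψ g) ≗ g) where

  private
    graph-sym : ∀ f g → χ (Q g) * χ (f =ᶠ ψ g) ≡ χ (P f) * χ (φ f =ᶠ g)
    graph-sym f g with Q g in Qg | f =ᶠ ψ g in f=ψg | P f in Pf | φ f =ᶠ g in φf=g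
    ... | true  | true  | true  | true  = refl
    ... | false | _     | false | _     = refl
    ... | true  | false | false | _     = refl
    ... | true  | false | true  | false = refl
    ... | false | _     | true  | false = refl
    ... | true  | true  | false | _ = ⊥-elim (false≢true (trans (sym Pf) (trans (P-resp f (ψ g) (=ᶠ-sound f (ψ g) f=ψg)) (ψ-maps g Qg))))
    ... | false | _     | true  | true = ⊥-elim (false≢true (trans (sym Qg) (trans (Q-resp g (φ f) (sym ∘ =ᶠ-sound (φ f) g φf=g)) (φ-maps f Pf))))
    ... | true  | false | true  | true = ⊥-elim (false≢true (trans (sym f=ψg) (=ᶠ-complete f (ψ g) (λ i →
                  trans (sym (ψ∘φ f Pf i)) (ψ-resp (φ f) g (=ᶠ-sound (φ f) g φf=g) i)))))
    ... | true  | true  | true  | false = ⊥-elim (false≢true (trans (sym φf=g) (=ᶠ-complete (φ f) g (λ i →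
                  trans (φ-resp f (ψ g) (=ᶠ-sound f (ψ g) f=ψg) i) (φ∘ψ g Qg i)))))

    ∑-graph : ∀ {m n} (R : (Fin m → Fin n) → Bool) (z : Fin m → Fin n) →
              ∑Maps m n (λ f → χ (R z) * χ (f =ᶠ z)) ≡ χ (R z)
    ∑-graph {m} {n} R z = trans (∑-*ˡ (allMaps m n) (χ (R z)) _)
                                (trans (cong (χ (R z) *_) (∑Maps-singleton m n z)) (*-identityʳ _))

  ∑Maps-bijection : ∑Maps a b (χ ∘ P) ≡ ∑Maps c d (χ ∘ Q)
  ∑Maps-bijection = begin
    ∑Maps a b (χ ∘ P)
      ≡⟨ ∑-cong (allMaps a b) (λ f → sym (trans (∑-cong (allMaps c d) (λ g → cong (λ t → χ (P f) * χ t) (=ᶠ-sym (φ f) g)))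
                                                 (∑-graph (λ _ → P f) (φ f)))) ⟩
    ∑Maps a b (λ f → ∑Maps c d (λ g → χ (P f) * χ (φ f =ᶠ g)))
      ≡⟨ ∑-swap (allMaps a b) (allMaps c d) _ ⟩
    ∑Maps c d (λ g → ∑Maps a b (λ f → χ (P f) * χ (φ f =ᶠ g)))
      ≡⟨ ∑-cong (allMaps c d) (λ g → ∑-cong (allMaps a b) (λ f → sym (graph-sym f g))) ⟩
    ∑Maps c d (λ g → ∑Maps a b (λ f → χ (Q g) * χ (f =ᶠ ψ g)))
      ≡⟨ ∑-cong (allMaps c d) (λ g → ∑-graph (λ _ → Q g) (ψ g)) ⟩
    ∑Maps c d (χ ∘ Q) ∎

∑Maps-split : {a b m : ℕ} (key : (Fin a → Fin b) → Fin m) (h : (Fin a → Fin b) → ℕ) →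
              ∑Maps a b h ≡ ∑Fin m (λ p → ∑Maps a b (λ f → χ (key f == p) * h f))
∑Maps-split {a} {b} {m} key h = begin
  ∑Maps a b h
    ≡⟨ ∑-cong (allMaps a b) (λ f → sym (begin
         ∑Fin m (λ p → χ (key f == p) * h f) ≡⟨ ∑-*ʳ (allFin m) (h f) _ ⟩
         ∑Fin m (λ p → χ (key f == p)) * h f ≡⟨ cong (_* h f) (∑Fin-χ== m (key f)) ⟩
         1 * h f                              ≡⟨ *-identityˡ (h f) ⟩
         h f                                  ∎)) ⟩
  ∑Maps a b (λ f → ∑Fin m (λ p → χ (key f == p) * h f))
    ≡⟨ ∑-swap (allMaps a b) (allFin m) _ ⟩
  ∑Fin m (λ p → ∑Maps a b (λ f → χ (key f == p) * h f)) ∎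

∑Maps-χ-positive : {a b : ℕ} (P : (Fin a → Fin b) → Bool) → Respects≗ P →
                   (f : Fin a → Fin b) → P f ≡ true → 0 < ∑Maps a b (χ ∘ P)
∑Maps-χ-positive {a} {b} P P-resp f Pf =
  subst (_≤ ∑Maps a b (χ ∘ P)) (∑Maps-singleton a b f) (∑-mono (allMaps a b) f-only)
  where
  f-only : ∀ g → χ (g =ᶠ f) ≤ χ (P g)
  f-only g = χ-mono (λ g=f → trans (P-resp g f (=ᶠ-sound g f g=f)) Pf)

∧-true⁻ : ∀ a b → a ∧ b ≡ true → a ≡ true × b ≡ true
∧-true⁻ true true _ = refl , refl

∧-true⁺ : ∀ {a b} → a ≡ true → b ≡ true → a ∧ b ≡ true
∧-true⁺ refl refl = refl

∨-true⁻ : ∀ a b → a ∨ b ≡ true → a ≡ true ⊎ b ≡ true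
∨-true⁻ true  b _   = inj₁ refl
∨-true⁻ false b b≡t = inj₂ b≡t

∨-true⁺ˡ : ∀ {a} b → a ≡ true → a ∨ b ≡ true
∨-true⁺ˡ b refl = refl

∨-true⁺ʳ : ∀ a {b} → b ≡ true → a ∨ b ≡ true
∨-true⁺ʳ a refl = Boolₚ.∨-zeroʳ a

module _ {X : Set} where

  any-tabulate⁺ : ∀ {m} (f : Fin m → X) (p : X → Bool) (i : Fin m) →
                  p (f i) ≡ true → any p (tabulate f) ≡ true
  any-tabulate⁺ f p zero    pfi = ∨-true⁺ˡ _ pfi
  any-tabulate⁺ f p (suc i) pfi = ∨-true⁺ʳ (p (f zero)) (any-tabulate⁺ (f ∘ suc) p i pfi)

  any-tabulate⁻ : ∀ {m} (f : Fin m → X) (p : X → Bool) →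
                  any p (tabulate f) ≡ true → ∃[ i ] p (f i) ≡ true
  any-tabulate⁻ {suc m} f p any≡t with p (f zero) in pf0
  ... | true  = zero , pf0
  ... | false with any-tabulate⁻ (f ∘ suc) p any≡t
  ...   | i , pfi = suc i , pfi

  any-tabulate-false⁻ : ∀ {m} (f : Fin m → X) (p : X → Bool) →
                        any p (tabulate f) ≡ false → ∀ i → p (f i) ≡ false
  any-tabulate-false⁻ f p any≡f i with p (f i) in pfi
  ... | false = refl
  ... | true  = ⊥-elim (false≢true (trans (sym any≡f) (any-tabulate⁺ f p i pfi)))

  all-tabulate⁺ : ∀ {m} (f : Fin m → X) (p : X → Bool) →
                  (∀ i → p (f i) ≡ true) → all p (tabulate f) ≡ true
  all-tabulate⁺ {zero}  f p pf = refl
  all-tabulate⁺ {suc m} f p pf rewrite pf zero = all-tabulate⁺ (f ∘ suc) p (pf ∘ suc)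

  all-tabulate⁻ : ∀ {m} (f : Fin m → X) (p : X → Bool) →
                  all p (tabulate f) ≡ true → ∀ i → p (f i) ≡ true
  all-tabulate⁻ {suc m} f p all≡t i with p (f zero) in pf0 | i
  all-tabulate⁻ {suc m} f p ()    i | false | _
  ... | true | zero  = pf0
  ... | true | suc j = all-tabulate⁻ (f ∘ suc) p all≡t j

  all-tabulate-false⁻ : ∀ {m} (f : Fin m → X) (p : X → Bool) →
                        all p (tabulate f) ≡ false → ∃[ i ] p (f i) ≡ false
  all-tabulate-false⁻ {suc m} f p all≡f with p (f zero) in pf0
  ... | false = zero , pf0
  ... | true with all-tabulate-false⁻ (f ∘ suc) p all≡f
  ...   | i , pfi = suc i , pfi

  any-cong : (xs : List X) {p q : X → Bool} → (∀ x → p x ≡ q x) → any p xs ≡ any q xs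
  any-cong []       p≗q = refl
  any-cong (x ∷ xs) p≗q = cong₂ _∨_ (p≗q x) (any-cong xs p≗q)

  all-cong : (xs : List X) {p q : X → Bool} → (∀ x → p x ≡ q x) → all p xs ≡ all q xs
  all-cong []       p≗q = refl
  all-cong (x ∷ xs) p≗q = cong₂ _∧_ (p≗q x) (all-cong xs p≗q)

  any-false : (xs : List X) {p : X → Bool} → (∀ x → p x ≡ false) → any p xs ≡ false
  any-false []       p≡f = refl
  any-false (x ∷ xs) p≡f rewrite p≡f x = any-false xs p≡f

-- Products of binomials

-- choiceCount L C counts the ways of picking one entry from each pair of L so that the sum
-- satisfies C; thus choiceCountAt L is the coefficient sequence of the product of the x ^ t + x ^ f.
choiceCount : List (ℕ × ℕ) → (ℕ → Bool) → ℕ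
choiceCount []            C = χ (C 0)
choiceCount ((t , f) ∷ L) C = choiceCount L (λ k → C (t + k)) + choiceCount L (λ k → C (f + k))

choiceCountAt : List (ℕ × ℕ) → ℕ → ℕ
choiceCountAt L s = choiceCount L (λ k → does (k ≟ s))

choiceCount-cong : (L : List (ℕ × ℕ)) {C C′ : ℕ → Bool} → (∀ k → C k ≡ C′ k) →
                   choiceCount L C ≡ choiceCount L C′
choiceCount-cong []            C≗C′ = cong χ (C≗C′ 0)
choiceCount-cong ((t , f) ∷ L) C≗C′ =
  cong₂ _+_ (choiceCount-cong L (C≗C′ ∘ (t +_))) (choiceCount-cong L (C≗C′ ∘ (f +_)))

choiceCount-false : (L : List (ℕ × ℕ)) {C : ℕ → Bool} → (∀ k → C k ≡ false) → choiceCount L C ≡ 0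
choiceCount-false []            C≡f = cong χ (C≡f 0)
choiceCount-false ((t , f) ∷ L) C≡f =
  cong₂ _+_ (choiceCount-false L (C≡f ∘ (t +_))) (choiceCount-false L (C≡f ∘ (f +_)))

shift : ℕ → (ℕ → ℕ) → ℕ → ℕ
shift a q s = if does (a ≤? s) then q (s ∸ a) else 0

-- subsetSums D s is the coefficient of x ^ s in the product of the 1 + x ^ d over d ∈ D.
subsetSums : List ℕ → ℕ → ℕ
subsetSums []      s = χ (does (s ≟ 0))
subsetSums (d ∷ D) s = subsetSums D s + shift d (subsetSums D) s

gap : ℕ × ℕ → ℕ
gap (t , f) = ∣ t - f ∣

∑min : List (ℕ × ℕ) → ℕ
∑min []            = 0
∑min ((t , f) ∷ L) = t ⊓ f + ∑min L

shift-cong : ∀ a {q r : ℕ → ℕ} → (∀ u → q u ≡ r u) → ∀ s → shift a q s ≡ shift a r s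
shift-cong a q≗r s with does (a ≤? s)
... | true  = q≗r (s ∸ a)
... | false = refl

shift-+ : ∀ a (q r : ℕ → ℕ) s → shift a (λ u → q u + r u) s ≡ shift a q s + shift a r s
shift-+ a q r s with does (a ≤? s)
... | true  = refl
... | false = refl

shift-*ˡ : ∀ a c (q : ℕ → ℕ) s → shift a (λ u → c * q u) s ≡ c * shift a q s
shift-*ˡ a c q s with does (a ≤? s)
... | true  = refl
... | false = sym (*-zeroʳ c)

shift-≤ : ∀ {a s} (q : ℕ → ℕ) → a ≤ s → shift a q s ≡ q (s ∸ a)
shift-≤ {a} {s} q a≤s rewrite dec-true (a ≤? s) a≤s = refl

shift-≰ : ∀ {a s} (q : ℕ → ℕ) → ¬ (a ≤ s) → shift a q s ≡ 0
shift-≰ {a} {s} q a≰s rewrite dec-false (a ≤? s) a≰s = refl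

shift-< : ∀ a (q : ℕ → ℕ) s → s < a → shift a q s ≡ 0
shift-< a q s s<a = shift-≰ q (<⇒≱ s<a)

shift-+ˡ : ∀ a (q : ℕ → ℕ) u → shift a q (a + u) ≡ q u
shift-+ˡ a q u = trans (shift-≤ q (m≤m+n a u)) (cong q (m+n∸m≡n a u))

shift-shift : ∀ a b (q : ℕ → ℕ) s → shift a (shift b q) s ≡ shift (a + b) q s
shift-shift a b q s with a ≤? s
... | no a≰s = trans (shift-≰ (shift b q) a≰s) (sym (shift-≰ q (λ a+b≤s → a≰s (≤-trans (m≤m+n a b) a+b≤s))))
... | yes a≤s with b ≤? s ∸ a
...   | yes b≤s∸a = begin
  shift a (shift b q) s ≡⟨ shift-≤ (shift b q) a≤s ⟩
  shift b q (s ∸ a)     ≡⟨ shift-≤ q b≤s∸a ⟩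
  q (s ∸ a ∸ b)         ≡⟨ cong q (∸-+-assoc s a b) ⟩
  q (s ∸ (a + b))       ≡⟨ shift-≤ q (subst (_≤ s) (+-comm b a) (subst (b + a ≤_) (m∸n+n≡m a≤s) (+-monoˡ-≤ a b≤s∸a))) ⟨
  shift (a + b) q s     ∎
...   | no b≰s∸a = trans (shift-≤ (shift b q) a≤s) (trans (shift-≰ q b≰s∸a) (sym (shift-≰ q a+b≰s)))
  where
  a+b≰s : ¬ (a + b ≤ s)
  a+b≰s a+b≤s = b≰s∸a (subst (_≤ s ∸ a) (m+n∸n≡m b a) (∸-monoˡ-≤ a (subst (_≤ s) (+-comm a b) a+b≤s)))

choiceCount-shift : (L : List (ℕ × ℕ)) (t s : ℕ) →
                    choiceCount L (λ k → does (t + k ≟ s)) ≡ shift t (choiceCountAt L) s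
choiceCount-shift L t s with t ≤? s
... | yes t≤s = trans (choiceCount-cong L t+k≟s⇔k≟s∸t) (sym (shift-≤ (choiceCountAt L) t≤s))
  where
  t+k≟s⇔k≟s∸t : ∀ k → does (t + k ≟ s) ≡ does (k ≟ s ∸ t)
  t+k≟s⇔k≟s∸t k = does-⇔ (mk⇔ (λ t+k≡s → trans (sym (m+n∸m≡n t k)) (cong (_∸ t) t+k≡s))
                              (λ k≡s∸t → trans (cong (t +_) k≡s∸t) (m+[n∸m]≡n t≤s)))
                         (t + k ≟ s) (k ≟ s ∸ t)
... | no t≰s = trans (choiceCount-false L (λ k → dec-false (t + k ≟ s) (λ t+k≡s → t≰s (subst (t ≤_) t+k≡s (m≤m+n t k)))))
                     (sym (shift-≰ (choiceCountAt L) t≰s))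

min-gap-split : ∀ t f → (t ≡ t ⊓ f × f ≡ t ⊓ f + ∣ t - f ∣) ⊎ (f ≡ t ⊓ f × t ≡ t ⊓ f + ∣ t - f ∣)
min-gap-split t f with ≤-total t f
... | inj₁ t≤f = inj₁ (sym (m≤n⇒m⊓n≡m t≤f) ,
                       trans (sym (m+[n∸m]≡n t≤f)) (cong₂ _+_ (sym (m≤n⇒m⊓n≡m t≤f)) (sym (m≤n⇒∣m-n∣≡n∸m t≤f))))
... | inj₂ f≤t = inj₂ (sym (m≥n⇒m⊓n≡n f≤t) ,
                       trans (sym (m+[n∸m]≡n f≤t))
                             (cong₂ _+_ (sym (m≥n⇒m⊓n≡n f≤t)) (trans (sym (m≤n⇒∣m-n∣≡n∸m f≤t)) (∣-∣-comm f t))))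

-- The product of the x ^ t + x ^ f is x ^ (t ⊓ f) (1 + x ^ ∣ t - f ∣) factor by factor.
choiceCountAt≡shift-subsetSums : (L : List (ℕ × ℕ)) (s : ℕ) →
  choiceCountAt L s ≡ shift (∑min L) (subsetSums (map gap L)) s
choiceCountAt≡shift-subsetSums []            s =
  trans (cong χ (does-⇔ (mk⇔ sym sym) (0 ≟ s) (s ≟ 0))) (sym (shift-≤ (subsetSums []) (z≤n {s})))
choiceCountAt≡shift-subsetSums ((t , f) ∷ L) s = begin
  choiceCount L (λ k → does (t + k ≟ s)) + choiceCount L (λ k → does (f + k ≟ s))
    ≡⟨ cong₂ _+_ (choiceCount-shift L t s) (choiceCount-shift L f s) ⟩
  shift t (choiceCountAt L) s + shift f (choiceCountAt L) s
    ≡⟨ cong₂ _+_ (shift-cong t (choiceCountAt≡shift-subsetSums L) s) (shift-cong f (choiceCountAt≡shift-subsetSums L) s) ⟩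
  shift t (shift K q) s + shift f (shift K q) s
    ≡⟨ cong₂ _+_ (shift-shift t K q s) (shift-shift f K q s) ⟩
  shift (t + K) q s + shift (f + K) q s
    ≡⟨ by-min-gap (min-gap-split t f) ⟩
  shift (m + K) q s + shift (m + K) (shift d q) s
    ≡⟨ shift-+ (m + K) q (shift d q) s ⟨
  shift (m + K) (subsetSums (d ∷ map gap L)) s ∎
  where
  K m d : ℕ
  K = ∑min L
  m = t ⊓ f
  d = ∣ t - f ∣
  q : ℕ → ℕ
  q = subsetSums (map gap L)
  long : shift (m + d + K) q s ≡ shift (m + K) (shift d q) s
  long = trans (cong (λ e → shift e q s) (trans (+-assoc m d K) (trans (cong (m +_) (+-comm d K)) (sym (+-assoc m K d)))))
               (sym (shift-shift (m + K) d q s))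
  by-min-gap : (t ≡ m × f ≡ m + d) ⊎ (f ≡ m × t ≡ m + d) →
               shift (t + K) q s + shift (f + K) q s ≡ shift (m + K) q s + shift (m + K) (shift d q) s
  by-min-gap (inj₁ (t≡m , f≡m+d)) =
    trans (cong₂ (λ x y → shift (x + K) q s + shift (y + K) q s) t≡m f≡m+d) (cong (shift (m + K) q s +_) long)
  by-min-gap (inj₂ (f≡m , t≡m+d)) =
    trans (+-comm (shift (t + K) q s) _)
          (trans (cong₂ (λ x y → shift (x + K) q s + shift (y + K) q s) f≡m t≡m+d) (cong (shift (m + K) q s +_) long))

positives : List ℕ → List ℕ
positives = filter (0 <?_)

zeros : List ℕ → ℕ
zeros []          = 0
zeros (zero ∷ D)  = suc (zeros D)
zeros (suc d ∷ D) = zeros D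

All-positive-positives : (D : List ℕ) → All (0 <_) (positives D)
All-positive-positives []          = []
All-positive-positives (zero ∷ D)  = All-positive-positives D
All-positive-positives (suc d ∷ D) = z<s ∷ All-positive-positives D

subsetSums-positives : (D : List ℕ) (u : ℕ) → subsetSums D u ≡ 2 ^ zeros D * subsetSums (positives D) u
subsetSums-positives []          u = sym (+-identityʳ _)
subsetSums-positives (zero ∷ D)  u = begin
  subsetSums D u + subsetSums D u ≡⟨ cong₂ _+_ (subsetSums-positives D u) (subsetSums-positives D u) ⟩
  c * x + c * x                   ≡⟨ cong (c * x +_) (+-identityʳ (c * x)) ⟨
  2 * (c * x)                     ≡⟨ *-assoc 2 c x ⟨
  2 * c * x                       ∎
  where
  c x : ℕ
  c = 2 ^ zeros D
  x = subsetSums (positives D) u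
subsetSums-positives (suc d ∷ D) u = begin
  subsetSums D u + shift (suc d) (subsetSums D) u
    ≡⟨ cong₂ _+_ (subsetSums-positives D u)
                 (trans (shift-cong (suc d) (subsetSums-positives D) u) (shift-*ˡ (suc d) c (subsetSums (positives D)) u)) ⟩
  c * subsetSums (positives D) u + c * shift (suc d) (subsetSums (positives D)) u
    ≡⟨ *-distribˡ-+ c _ _ ⟨
  c * subsetSums (suc d ∷ positives D) u ∎
  where
  c : ℕ
  c = 2 ^ zeros D

subsetSums-0-positive : (D : List ℕ) → 0 < subsetSums D 0
subsetSums-0-positive []      = z<s
subsetSums-0-positive (d ∷ D) = ≤-trans (subsetSums-0-positive D) (m≤m+n _ _)

subsetSums-0 : (D : List ℕ) → All (0 <_) D → subsetSums D 0 ≡ 1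
subsetSums-0 []      []            = refl
subsetSums-0 (d ∷ D) (d>0 ∷ D>0) = cong₂ _+_ (subsetSums-0 D D>0) (shift-< d (subsetSums D) 0 d>0)

subsetSums-∷-cong : ∀ x {A B : List ℕ} → subsetSums A ≗ subsetSums B → subsetSums (x ∷ A) ≗ subsetSums (x ∷ B)
subsetSums-∷-cong x A≗B u = cong₂ _+_ (A≗B u) (shift-cong x A≗B u)

subsetSums-swap : ∀ x y (A : List ℕ) → subsetSums (x ∷ y ∷ A) ≗ subsetSums (y ∷ x ∷ A)
subsetSums-swap x y A u = begin
  (q u + shift y q u) + shift x (λ v → q v + shift y q v) u
    ≡⟨ cong ((q u + shift y q u) +_) (trans (shift-+ x q (shift y q) u) (cong (shift x q u +_) (shift-shift x y q u))) ⟩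
  (q u + shift y q u) + (shift x q u + shift (x + y) q u)
    ≡⟨ interchange (q u) (shift y q u) (shift x q u) _ ⟩
  (q u + shift x q u) + (shift y q u + shift (x + y) q u)
    ≡⟨ cong (λ e → (q u + shift x q u) + (shift y q u + shift e q u)) (+-comm x y) ⟩
  (q u + shift x q u) + (shift y q u + shift (y + x) q u)
    ≡⟨ cong ((q u + shift x q u) +_) (trans (shift-+ y q (shift x q) u) (cong (shift y q u +_) (shift-shift y x q u))) ⟨
  (q u + shift x q u) + shift y (λ v → q v + shift x q v) u ∎
  where
  q : ℕ → ℕ
  q = subsetSums A

subsetSums-↭ : {A B : List ℕ} → A ↭ B → subsetSums A ≗ subsetSums B
subsetSums-↭ ↭.refl                     = λ _ → refl
subsetSums-↭ {x ∷ A} {x ∷ B} (↭.prep x A↭B) = subsetSums-∷-cong x {A} {B} (subsetSums-↭ A↭B)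
subsetSums-↭ {x ∷ y ∷ A} {y ∷ x ∷ B} (↭.swap x y A↭B) u =
  trans (subsetSums-swap x y A u)
        (subsetSums-∷-cong y {x ∷ A} {x ∷ B} (subsetSums-∷-cong x {A} {B} (subsetSums-↭ A↭B)) u)
subsetSums-↭ (↭.trans A↭B B↭C) u       = trans (subsetSums-↭ A↭B u) (subsetSums-↭ B↭C u)

subsetSums-below-min : (m : ℕ) (X : List ℕ) → All (m ≤_) X → ∀ u → 0 < u → u < m → subsetSums X u ≡ 0
subsetSums-below-min m []      []             (suc u) _   u<m = refl
subsetSums-below-min m (x ∷ X) (m≤x ∷ m≤X) u       u>0 u<m =
  cong₂ _+_ (subsetSums-below-min m X m≤X u u>0 u<m) (shift-< x (subsetSums X) u (<-≤-trans u<m m≤x))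

subsetSums-at-head : (m : ℕ) (X : List ℕ) → 0 < subsetSums (m ∷ X) m
subsetSums-at-head m X =
  ≤-trans (subst (0 <_) (sym (trans (shift-≤ (subsetSums X) (≤-refl {m})) (cong (subsetSums X) (n∸n≡0 m))))
                 (subsetSums-0-positive X))
          (m≤n+m _ (subsetSums X m))

subsetSums-cancel : (m : ℕ) → 0 < m → (X Y : List ℕ) → subsetSums (m ∷ X) ≗ subsetSums (m ∷ Y) → subsetSums X ≗ subsetSums Y
subsetSums-cancel m m>0 X Y mX≗mY u = below (suc u) u ≤-refl
  where
  below : ∀ bound u → u < bound → subsetSums X u ≡ subsetSums Y u
  below (suc bound) u u<bound =
    +-cancelʳ-≡ (shift m (subsetSums X) u) (subsetSums X u) (subsetSums Y u)
                (trans (mX≗mY u) (cong (subsetSums Y u +_) (sym shifted)))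
    where
    shifted : shift m (subsetSums X) u ≡ shift m (subsetSums Y) u
    shifted with m ≤? u
    ... | yes m≤u = trans (shift-≤ (subsetSums X) m≤u)
                          (trans (below bound (u ∸ m) (≤-trans (∸-monoʳ-< m>0 m≤u) (≤-pred u<bound)))
                                 (sym (shift-≤ (subsetSums Y) m≤u)))
    ... | no m≰u  = trans (shift-≰ (subsetSums X) m≰u) (sym (shift-≰ (subsetSums Y) m≰u))

subsetSums-injective : {A B : List ℕ} → Linked _≤_ A → Linked _≤_ B → All (0 <_) A → All (0 <_) B →
                       subsetSums A ≗ subsetSums B → A ≡ B
subsetSums-injective {[]}    {[]}    _ _ _ _ _ = refl
subsetSums-injective {[]}    {b ∷ B} _ _ _ (z<s ∷ _) A≗B =
  ⊥-elim (<-irrefl (A≗B b) (subsetSums-at-head b B))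
subsetSums-injective {a ∷ A} {[]}    _ _ (z<s ∷ _) _ A≗B =
  ⊥-elim (<-irrefl (sym (A≗B a)) (subsetSums-at-head a A))
subsetSums-injective {a ∷ A} {b ∷ B} A↗ B↗ (a>0 ∷ A>0) (b>0 ∷ B>0) A≗B with <-cmp a b
... | tri< a<b _ _ = ⊥-elim (<-irrefl (sym (trans (A≗B a) (subsetSums-below-min b (b ∷ B) (Linked⇒All ≤-trans ≤-refl B↗) a a>0 a<b)))
                                      (subsetSums-at-head a A))
... | tri> _ _ b<a = ⊥-elim (<-irrefl (sym (trans (sym (A≗B b)) (subsetSums-below-min a (a ∷ A) (Linked⇒All ≤-trans ≤-refl A↗) b b>0 b<a)))
                                      (subsetSums-at-head b B))
... | tri≈ _ refl _ = cong (a ∷_) (subsetSums-injective (Linked.tail A↗) (Linked.tail B↗) A>0 B>0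
                                                       (subsetSums-cancel a a>0 A B A≗B))

subsetSums-injective-↭ : {A B : List ℕ} → All (0 <_) A → All (0 <_) B → subsetSums A ≗ subsetSums B → A ↭ B
subsetSums-injective-↭ {A} {B} A>0 B>0 A≗B =
  ↭-trans (↭-sym (sort-↭ A)) (↭-trans (↭-reflexive sortA≡sortB) (sort-↭ B))
  where
  sortA≡sortB : sort A ≡ sort B
  sortA≡sortB = subsetSums-injective (sort-↗ A) (sort-↗ B)
    (All-resp-↭ (↭-sym (sort-↭ A)) A>0) (All-resp-↭ (↭-sym (sort-↭ B)) B>0)
    (λ u → trans (subsetSums-↭ (sort-↭ A) u) (trans (A≗B u) (sym (subsetSums-↭ (sort-↭ B) u))))

shift-self : ∀ K (q : ℕ → ℕ) → shift K q K ≡ q 0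
shift-self K q = trans (shift-≤ q (≤-refl {K})) (cong q (n∸n≡0 K))

shift-exponent-≮ : {K K′ : ℕ} (E E′ : ℕ) .{{_ : NonZero E}} (q q′ : ℕ → ℕ) .{{_ : NonZero (q 0)}} →
                   E * shift K q K ≡ E′ * shift K′ q′ K → ¬ (K < K′)
shift-exponent-≮ {K} {K′} E E′ q q′ same K<K′ = ≢-nonZero⁻¹ (E * q 0) {{m*n≢0 E (q 0)}} (begin
  E * q 0            ≡⟨ cong (E *_) (shift-self K q) ⟨
  E * shift K q K    ≡⟨ same ⟩
  E′ * shift K′ q′ K ≡⟨ cong (E′ *_) (shift-< K′ q′ K K<K′) ⟩
  E′ * 0             ≡⟨ *-zeroʳ E′ ⟩
  0                  ∎)

scaled-shift-exponent : {K K′ : ℕ} (E E′ : ℕ) .{{_ : NonZero E}} .{{_ : NonZero E′}}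
                        (q q′ : ℕ → ℕ) .{{_ : NonZero (q 0)}} .{{_ : NonZero (q′ 0)}} →
                        (∀ s → E * shift K q s ≡ E′ * shift K′ q′ s) → K ≡ K′
scaled-shift-exponent {K} {K′} E E′ q q′ same with <-cmp K K′
... | tri< K<K′ _ _ = ⊥-elim (shift-exponent-≮ E E′ q q′ (same K) K<K′)
... | tri≈ _ K≡K′ _ = K≡K′
... | tri> _ _ K′<K = ⊥-elim (shift-exponent-≮ E′ E q′ q (sym (same K′)) K′<K)

scaled-normalised-equal : (P P′ : ℕ) .{{_ : NonZero P}} {q q′ : ℕ → ℕ} → q 0 ≡ 1 → q′ 0 ≡ 1 →
                          (∀ u → P * q u ≡ P′ * q′ u) → q ≗ q′
scaled-normalised-equal P P′ {q} {q′} q0≡1 q′0≡1 same u =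
  *-cancelˡ-≡ (q u) (q′ u) P (trans (same u) (cong (_* q′ u) (sym P≡P′)))
  where
  P≡P′ : P ≡ P′
  P≡P′ = begin
    P        ≡⟨ *-identityʳ P ⟨
    P * 1    ≡⟨ cong (P *_) q0≡1 ⟨
    P * q 0  ≡⟨ same 0 ⟩
    P′ * q′ 0 ≡⟨ cong (P′ *_) q′0≡1 ⟩
    P′ * 1   ≡⟨ *-identityʳ P′ ⟩
    P′       ∎

positive-gaps-determined : (L L′ : List (ℕ × ℕ)) (E E′ : ℕ) .{{_ : NonZero E}} .{{_ : NonZero E′}} →
  (∀ s → E * choiceCountAt L s ≡ E′ * choiceCountAt L′ s) → positives (map gap L) ↭ positives (map gap L′)
positive-gaps-determined L L′ E E′ same =
  subsetSums-injective-↭ (All-positive-positives D) (All-positive-positives D′) normalised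
  where
  D D′ : List ℕ
  D  = map gap L
  D′ = map gap L′
  shifted : ∀ s → E * shift (∑min L) (subsetSums D) s ≡ E′ * shift (∑min L′) (subsetSums D′) s
  shifted s = begin
    E * shift (∑min L) (subsetSums D) s    ≡⟨ cong (E *_) (choiceCountAt≡shift-subsetSums L s) ⟨
    E * choiceCountAt L s                  ≡⟨ same s ⟩
    E′ * choiceCountAt L′ s                ≡⟨ cong (E′ *_) (choiceCountAt≡shift-subsetSums L′ s) ⟩
    E′ * shift (∑min L′) (subsetSums D′) s ∎
  K≡K′ : ∑min L ≡ ∑min L′
  K≡K′ = scaled-shift-exponent E E′ (subsetSums D) (subsetSums D′)
           {{>-nonZero (subsetSums-0-positive D)}} {{>-nonZero (subsetSums-0-positive D′)}} shifted
  unshifted : ∀ u → E * subsetSums D u ≡ E′ * subsetSums D′ u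
  unshifted u = begin
    E * subsetSums D u                             ≡⟨ cong (E *_) (shift-+ˡ (∑min L) (subsetSums D) u) ⟨
    E * shift (∑min L) (subsetSums D) (∑min L + u) ≡⟨ shifted (∑min L + u) ⟩
    E′ * shift (∑min L′) (subsetSums D′) (∑min L + u) ≡⟨ cong (λ K → E′ * shift (∑min L′) (subsetSums D′) (K + u)) K≡K′ ⟩
    E′ * shift (∑min L′) (subsetSums D′) (∑min L′ + u) ≡⟨ cong (E′ *_) (shift-+ˡ (∑min L′) (subsetSums D′) u) ⟩
    E′ * subsetSums D′ u                           ∎
  c c′ : ℕ
  c  = 2 ^ zeros D
  c′ = 2 ^ zeros D′
  normalised : subsetSums (positives D) ≗ subsetSums (positives D′)
  normalised = scaled-normalised-equal (E * c) (E′ * c′) {{m*n≢0 E c {{it}} {{m^n≢0 2 (zeros D)}}}}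
    (subsetSums-0 _ (All-positive-positives D)) (subsetSums-0 _ (All-positive-positives D′))
    (λ u → begin
      E * c * subsetSums (positives D) u      ≡⟨ *-assoc E c _ ⟩
      E * (c * subsetSums (positives D) u)    ≡⟨ cong (E *_) (subsetSums-positives D u) ⟨
      E * subsetSums D u                      ≡⟨ unshifted u ⟩
      E′ * subsetSums D′ u                    ≡⟨ cong (E′ *_) (subsetSums-positives D′ u) ⟩
      E′ * (c′ * subsetSums (positives D′) u) ≡⟨ *-assoc E′ c′ _ ⟨
      E′ * c′ * subsetSums (positives D′) u   ∎)

palindromic-agree : (N : ℕ) (U U′ : ℕ → ℕ) → (∀ s → N < s → U s ≡ U′ s) → U 0 ≡ U′ 0 →
                    (∀ s → s ≤ N → U s ≡ U (N ∸ s)) → (∀ s → s ≤ N → U′ s ≡ U′ (N ∸ s)) →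
                    (∀ a → 0 < a → a + a ≤ N → U a ≡ U′ a) → ∀ s → U s ≡ U′ s
palindromic-agree N U U′ beyond at-0 palindromic palindromic′ first-half s with N <? s
... | yes N<s = beyond s N<s
... | no N≮s with s + s ≤? N
...   | yes s+s≤N = up-to-half s s+s≤N
  where
  up-to-half : ∀ t → t + t ≤ N → U t ≡ U′ t
  up-to-half zero    _       = at-0
  up-to-half (suc t) t+t≤N = first-half (suc t) z<s t+t≤N
...   | no s+s≰N = begin
  U s         ≡⟨ palindromic s s≤N ⟩
  U (N ∸ s)   ≡⟨ mirrored (N ∸ s) refl ⟩
  U′ (N ∸ s)  ≡⟨ palindromic′ s s≤N ⟨
  U′ s        ∎
  where
  s≤N : s ≤ N
  s≤N = ≮⇒≥ N≮s
  mirror-small : (N ∸ s) + (N ∸ s) ≤ N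
  mirror-small = ≤-trans (+-monoʳ-≤ (N ∸ s) (m≤n+o⇒m∸n≤o N s (<⇒≤ (≰⇒> s+s≰N))))
                         (≤-reflexive (m∸n+n≡m s≤N))
  mirrored : ∀ t → t ≡ N ∸ s → U t ≡ U′ t
  mirrored zero    _      = at-0
  mirrored (suc t) t≡N∸s = first-half (suc t) z<s (subst (λ t → t + t ≤ N) (sym t≡N∸s) mirror-small)

-- Connected components

module Connectivity (G : Graph) where

  N : ℕ
  N = n G

  V : Set
  V = Fin N

  adj-sym : (u v : V) → adj G u v ≡ true → adj G v u ≡ true
  adj-sym u v uv = trans (Graph.sym G v u) uv

  reachK-refl : ∀ k (u : V) → reachK G k u u ≡ true
  reachK-refl zero    u = ==-refl u
  reachK-refl (suc k) u = ∨-true⁺ˡ _ (reachK-refl k u)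

  reachK-suc : ∀ k (u v : V) → reachK G k u v ≡ true → reachK G (suc k) u v ≡ true
  reachK-suc k u v = ∨-true⁺ˡ _

  reachK-mono : ∀ {k j} → k ≤ j → (u v : V) → reachK G k u v ≡ true → reachK G j u v ≡ true
  reachK-mono {k} k≤j u v reach with m≤n⇒∃[o]m+o≡n k≤j
  ... | o , refl = extend o
    where
    extend : ∀ o → reachK G (k + o) u v ≡ true
    extend zero    rewrite +-identityʳ k = reach
    extend (suc o) rewrite +-suc k o     = reachK-suc (k + o) u v (extend o)

  reachK-snoc : ∀ k (u w v : V) → reachK G k u w ≡ true → adj G w v ≡ true → reachK G (suc k) u v ≡ true
  reachK-snoc k u w v uw wv = ∨-true⁺ʳ (reachK G k u v) (any-tabulate⁺ id _ w (cong₂ _∧_ uw wv))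

  reachK-suc⁻ : ∀ k (u v : V) → reachK G (suc k) u v ≡ true →
                reachK G k u v ≡ true ⊎ ∃[ w ] (reachK G k u w ≡ true × adj G w v ≡ true)
  reachK-suc⁻ k u v reach with ∨-true⁻ _ _ reach
  ... | inj₁ uv = inj₁ uv
  ... | inj₂ via with any-tabulate⁻ id _ via
  ...   | w , uwv = inj₂ (w , ∧-true⁻ _ _ uwv)

  reachK-invariant : {X : Set} (I : V → X) → (∀ w v → adj G w v ≡ true → I w ≡ I v) →
                     ∀ k (u v : V) → reachK G k u v ≡ true → I u ≡ I v
  reachK-invariant I I-adj zero    u v reach = cong I (==⇒≡ {x = u} {v} reach)
  reachK-invariant I I-adj (suc k) u v reach with reachK-suc⁻ k u v reach
  ... | inj₁ uv             = reachK-invariant I I-adj k u v uv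
  ... | inj₂ (w , uw , wv) = trans (reachK-invariant I I-adj k u w uw) (I-adj w v wv)

  reachK-cons : ∀ k (u w v : V) → adj G u w ≡ true → reachK G k w v ≡ true → reachK G (suc k) u v ≡ true
  reachK-cons zero    u w v uw wv with refl ← ==⇒≡ {x = w} {v} wv = reachK-snoc 0 u u v (reachK-refl 0 u) uw
  reachK-cons (suc k) u w v uw wv with reachK-suc⁻ k w v wv
  ... | inj₁ wv′                = reachK-suc (suc k) u v (reachK-cons k u w v uw wv′)
  ... | inj₂ (w′ , ww′ , w′v) = reachK-snoc (suc k) u w′ v (reachK-cons k u w w′ uw ww′) w′v

  reachK-sym : ∀ k (u v : V) → reachK G k u v ≡ true → reachK G k v u ≡ true
  reachK-sym zero    u v uv with refl ← ==⇒≡ {x = u} {v} uv = reachK-refl 0 v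
  reachK-sym (suc k) u v uv with reachK-suc⁻ k u v uv
  ... | inj₁ uv′             = reachK-suc k v u (reachK-sym k u v uv′)
  ... | inj₂ (w , uw , wv) = reachK-cons k v w u (adj-sym w v wv) (reachK-sym k u w uw)

  reachK-trans : ∀ j k (u v w : V) → reachK G j u v ≡ true → reachK G k v w ≡ true → reachK G (j + k) u w ≡ true
  reachK-trans j zero    u v w uv vw with refl ← ==⇒≡ {x = v} {w} vw rewrite +-identityʳ j = uv
  reachK-trans j (suc k) u v w uv vw rewrite +-suc j k with reachK-suc⁻ k v w vw
  ... | inj₁ vw′               = reachK-suc (j + k) u w (reachK-trans j k u v w uv vw′)
  ... | inj₂ (w′ , vw′ , w′w) = reachK-snoc (j + k) u w′ w (reachK-trans j k u v w′ uv vw′) w′w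

  Stable : ℕ → V → Set
  Stable k u = ∀ v → reachK G (suc k) u v ≡ reachK G k u v

  Stable-suc : ∀ k u → Stable k u → Stable (suc k) u
  Stable-suc k u stable v =
    trans (cong (reachK G (suc k) u v ∨_) (any-cong (allFin N) (λ w → cong (_∧ adj G w v) (stable w))))
          (absorb (reachK G k u v) _)
    where
    absorb : ∀ a b → (a ∨ b) ∨ b ≡ a ∨ b
    absorb a b = trans (Boolₚ.∨-assoc a b b) (cong (a ∨_) (Boolₚ.∨-idem b))

  ball : ℕ → V → ℕ
  ball k u = ∑Fin N (λ v → χ (reachK G k u v))

  ball≤N : ∀ k u → ball k u ≤ N
  ball≤N k u = subst (ball k u ≤_) (trans (∑Fin-const N 1) (*-identityʳ N))
                     (∑-mono (allFin N) (λ v → χ-≤1 (reachK G k u v)))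

  -- Until the balls around u stabilise they grow strictly, so they stabilise within N steps.
  stable-or-large : ∀ k u → Stable k u ⊎ k < ball k u
  stable-or-large zero    u = inj₂ (subst (0 <_) (sym (∑Fin-χ== N u)) z<s)
  stable-or-large (suc k) u with stable-or-large k u
  ... | inj₁ stable = inj₁ (Stable-suc k u stable)
  ... | inj₂ large with all (λ v → does (reachK G (suc k) u v Boolₚ.≟ reachK G k u v)) (allFin N) in same
  ...   | true  = inj₁ (Stable-suc k u (λ v → does-true⇒ (_ Boolₚ.≟ _) (all-tabulate⁻ id _ same v)))
  ...   | false with all-tabulate-false⁻ id _ same
  ...     | v , new = inj₂ (<-≤-trans (s≤s large) (∑Fin-strict-mono N _ _ (λ x → χ-mono (reachK-suc k u x)) v
                                         (χ-< (reachK-suc k u v) (λ old≡new → false≢true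
                                            (trans (sym new) (dec-true (_ Boolₚ.≟ _) (sym old≡new)))))))

  Stable-N : ∀ u → Stable N u
  Stable-N u with stable-or-large N u
  ... | inj₁ stable = stable
  ... | inj₂ large  = ⊥-elim (<-irrefl refl (<-≤-trans large (ball≤N N u)))

  Stable-beyond-N : ∀ j u → Stable (N + j) u
  Stable-beyond-N zero    u rewrite +-identityʳ N = Stable-N u
  Stable-beyond-N (suc j) u rewrite +-suc N j     = Stable-suc (N + j) u (Stable-beyond-N j u)

  reachK-beyond-N : ∀ j u v → reachK G (N + j) u v ≡ connected G u v
  reachK-beyond-N zero    u v rewrite +-identityʳ N = refl
  reachK-beyond-N (suc j) u v rewrite +-suc N j     = trans (Stable-beyond-N j u v) (reachK-beyond-N j u v)

  reachK⇒connected : ∀ k (u v : V) → reachK G k u v ≡ true → connected G u v ≡ true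
  reachK⇒connected k u v reach with ≤-total k N
  ... | inj₁ k≤N = reachK-mono k≤N u v reach
  ... | inj₂ N≤k with m≤n⇒∃[o]m+o≡n N≤k
  ...   | j , refl = trans (sym (reachK-beyond-N j u v)) reach

  connected-refl : (u : V) → connected G u u ≡ true
  connected-refl = reachK-refl N

  connected-sym : (u v : V) → connected G u v ≡ true → connected G v u ≡ true
  connected-sym = reachK-sym N

  connected-trans : (u v w : V) → connected G u v ≡ true → connected G v w ≡ true → connected G u w ≡ true
  connected-trans u v w uv vw = reachK⇒connected (N + N) u w (reachK-trans N N u v w uv vw)

  adj⇒connected : (u v : V) → adj G u v ≡ true → connected G u v ≡ true
  adj⇒connected u v uv = reachK⇒connected (suc N) u v (reachK-snoc N u u v (connected-refl u) uv)

  connected-invariant : {X : Set} (I : V → X) → (∀ w v → adj G w v ≡ true → I w ≡ I v) →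
                        (u v : V) → connected G u v ≡ true → I u ≡ I v
  connected-invariant I I-adj = reachK-invariant I I-adj N

  isRep-minimal : (v u : V) → isRep G v ≡ true → toℕ u < toℕ v → connected G u v ≡ true → ⊥
  isRep-minimal v u v-rep u<v uv = false≢true (trans (sym (Boolₚ.not-injective v-rep))
    (any-tabulate⁺ id _ u (cong₂ _∧_ (dec-true (toℕ u <? toℕ v) u<v) uv)))

  isRep-false⁻ : (v : V) → isRep G v ≡ false → ∃[ u ] (toℕ u < toℕ v × connected G u v ≡ true)
  isRep-false⁻ v not-rep with any-tabulate⁻ id _ (Boolₚ.not-injective not-rep)
  ... | u , u<v∧uv with ∧-true⁻ _ _ u<v∧uv
  ...   | u<v , uv = u , does-true⇒ (toℕ u <? toℕ v) u<v , uv

  representative : (v : V) → ∃[ r ] (isRep G r ≡ true × connected G r v ≡ true)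
  representative v = below (suc (toℕ v)) v ≤-refl
    where
    below : ∀ bound (v : V) → toℕ v < bound → ∃[ r ] (isRep G r ≡ true × connected G r v ≡ true)
    below (suc bound) v v<bound with isRep G v in v-rep
    ... | true  = v , v-rep , connected-refl v
    ... | false with isRep-false⁻ v v-rep
    ...   | u , u<v , uv with below bound u (≤-trans u<v (≤-pred v<bound))
    ...     | r , r-rep , ru = r , r-rep , connected-trans r u v ru uv

  rep : V → V
  rep v = proj₁ (representative v)

  rep-isRep : (v : V) → isRep G (rep v) ≡ true
  rep-isRep v = proj₁ (proj₂ (representative v))

  rep-connected : (v : V) → connected G (rep v) v ≡ true
  rep-connected v = proj₂ (proj₂ (representative v))

  isRep-unique : (r r′ : V) → isRep G r ≡ true → isRep G r′ ≡ true → connected G r r′ ≡ true → r ≡ r′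
  isRep-unique r r′ r-rep r′-rep rr′ with <-cmp (toℕ r) (toℕ r′)
  ... | tri< r<r′ _ _ = ⊥-elim (isRep-minimal r′ r r′-rep r<r′ rr′)
  ... | tri≈ _ r≡r′ _ = Finₚ.toℕ-injective r≡r′
  ... | tri> _ _ r′<r = ⊥-elim (isRep-minimal r r′ r-rep r′<r (connected-sym r r′ rr′))

  rep-unique : (r x : V) → isRep G r ≡ true → connected G r x ≡ true → rep x ≡ r
  rep-unique r x r-rep rx = isRep-unique (rep x) r (rep-isRep x) r-rep
    (connected-trans (rep x) x r (rep-connected x) (connected-sym r x rx))

  rep-fixes-isRep : (r : V) → isRep G r ≡ true → rep r ≡ r
  rep-fixes-isRep r r-rep = rep-unique r r r-rep (connected-refl r)

  rep≡⇒connected : (r x : V) → rep x ≡ r → connected G r x ≡ true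
  rep≡⇒connected r x refl = rep-connected x

  rep-adj : (u v : V) → adj G u v ≡ true → rep u ≡ rep v
  rep-adj u v uv = sym (rep-unique (rep u) v (rep-isRep u)
    (connected-trans (rep u) u v (rep-connected u) (adj⇒connected u v uv)))

-- Fibres and types of maps

positiveValues : {b : ℕ} → (Fin b → ℕ) → List ℕ
positiveValues h = positives (tabulate h)

positiveValues-none : ∀ {b} (h : Fin b → ℕ) → (∀ w → h w ≡ 0) → positiveValues h ≡ []
positiveValues-none {zero}  h h≡0 = refl
positiveValues-none {suc b} h h≡0 =
  trans (filter-reject (0 <?_) (λ 0<h0 → <-irrefl (sym (h≡0 zero)) 0<h0)) (positiveValues-none (h ∘ suc) (h≡0 ∘ suc))

positiveValues-single : ∀ {b} (h : Fin b → ℕ) (p : Fin b) → (∀ w → w ≢ p → h w ≡ 0) → 0 < h p →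
                        positiveValues h ≡ h p ∷ []
positiveValues-single {suc b} h zero    h≡0 0<hp =
  trans (filter-accept (0 <?_) 0<hp) (cong (h zero ∷_) (positiveValues-none (h ∘ suc) (λ w → h≡0 (suc w) (λ ()))))
positiveValues-single {suc b} h (suc p) h≡0 0<hp =
  trans (filter-reject (0 <?_) (λ 0<h0 → <-irrefl (sym (h≡0 zero (λ ()))) 0<h0))
        (positiveValues-single (h ∘ suc) p (λ w w≢p → h≡0 (suc w) (w≢p ∘ Finₚ.suc-injective)) 0<hp)

positiveValues-pair : ∀ {b} (h : Fin b → ℕ) (p q : Fin b) → p ≢ q → (∀ w → w ≢ p → w ≢ q → h w ≡ 0) →
                      0 < h p → 0 < h q → positiveValues h ↭ h p ∷ h q ∷ []
positiveValues-pair {suc b} h zero    zero    p≢q _   _    _    = ⊥-elim (p≢q refl)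
positiveValues-pair {suc b} h zero    (suc q) p≢q h≡0 0<hp 0<hq
  rewrite filter-accept (0 <?_) {xs = tabulate (h ∘ suc)} 0<hp
        | positiveValues-single (h ∘ suc) q (λ w w≢q → h≡0 (suc w) (λ ()) (w≢q ∘ Finₚ.suc-injective)) 0<hq = ↭-refl
positiveValues-pair {suc b} h (suc p) zero    p≢q h≡0 0<hp 0<hq
  rewrite filter-accept (0 <?_) {xs = tabulate (h ∘ suc)} 0<hq
        | positiveValues-single (h ∘ suc) p (λ w w≢p → h≡0 (suc w) (w≢p ∘ Finₚ.suc-injective) (λ ())) 0<hp = ↭-swap _ _ ↭-refl
positiveValues-pair {suc b} h (suc p) (suc q) p≢q h≡0 0<hp 0<hq
  rewrite filter-reject (0 <?_) {xs = tabulate (h ∘ suc)} (λ 0<h0 → <-irrefl (sym (h≡0 zero (λ ()) (λ ()))) 0<h0) =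
  positiveValues-pair (h ∘ suc) p q (p≢q ∘ cong suc)
    (λ w w≢p w≢q → h≡0 (suc w) (w≢p ∘ Finₚ.suc-injective) (w≢q ∘ Finₚ.suc-injective)) 0<hp 0<hq

length-positiveValues : ∀ {b} (h : Fin b → ℕ) → length (positiveValues h) ≡ ∑Fin b (λ w → χ (does (0 <? h w)))
length-positiveValues {b} h = trans (length-filter≡∑ (0 <?_) (tabulate h)) (∑-tabulate b h (λ k → χ (does (0 <? k))))

sum-positives : (xs : List ℕ) → sum (positives xs) ≡ sum xs
sum-positives []           = refl
sum-positives (zero  ∷ xs) = sum-positives xs
sum-positives (suc x ∷ xs) = cong (suc x +_) (sum-positives xs)

sum-tabulate : ∀ {b} (h : Fin b → ℕ) → sum (tabulate h) ≡ ∑Fin b h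
sum-tabulate {zero}  h = refl
sum-tabulate {suc b} h = trans (cong (h zero +_) (sum-tabulate (h ∘ suc))) (sym (∑Fin-suc b h))

module _ {a b : ℕ} where

  fiberSize≡∑ : (f : Fin a → Fin b) (w : Fin b) → fiberSize f w ≡ ∑Fin a (λ u → χ (f u == w))
  fiberSize≡∑ f w = length-filter≡∑ (λ u → f u Finₚ.≟ w) (allFin a)

  fiberSize-resp : (f g : Fin a → Fin b) → f ≗ g → (w : Fin b) → fiberSize f w ≡ fiberSize g w
  fiberSize-resp f g f≗g w = trans (fiberSize≡∑ f w)
    (trans (∑-cong (allFin a) (λ u → cong (λ x → χ (x == w)) (f≗g u))) (sym (fiberSize≡∑ g w)))

  ∑-fiberSize : (f : Fin a → Fin b) → ∑Fin b (fiberSize f) ≡ a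
  ∑-fiberSize f = begin
    ∑Fin b (fiberSize f)                           ≡⟨ ∑-cong (allFin b) (fiberSize≡∑ f) ⟩
    ∑Fin b (λ w → ∑Fin a (λ u → χ (f u == w)))     ≡⟨ ∑-swap (allFin b) (allFin a) _ ⟩
    ∑Fin a (λ u → ∑Fin b (λ w → χ (f u == w)))     ≡⟨ ∑-cong (allFin a) (λ u → ∑Fin-χ== b (f u)) ⟩
    ∑Fin a (λ _ → 1)                               ≡⟨ ∑Fin-const a 1 ⟩
    a * 1                                          ≡⟨ *-identityʳ a ⟩
    a                                              ∎

  fiberSize-image : (f : Fin a → Fin b) (x : Fin a) → 0 < fiberSize f (f x)
  fiberSize-image f x = subst (0 <_) (sym (fiberSize≡∑ f (f x)))
    (≤-trans (≤-reflexive (sym (∑Fin-selectˡ a x (λ _ → 1)))) (∑-mono (allFin a) x-in-fiber))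
    where
    x-in-fiber : ∀ u → χ (u == x) * 1 ≤ χ (f u == f x)
    x-in-fiber u with u Finₚ.≟ x
    ... | yes refl rewrite ==-refl (f u) = s≤s z≤n
    ... | no _     = z≤n

  fiberSize-outside-image : (f : Fin a → Fin b) (w : Fin b) → (∀ x → f x ≢ w) → fiberSize f w ≡ 0
  fiberSize-outside-image f w f≢w =
    trans (fiberSize≡∑ f w) (∑-χ-false (allFin a) (λ u → ≢⇒==false (f≢w u)))

  fiberSize-zero⇒≢ : (f : Fin a → Fin b) (w : Fin b) → fiberSize f w ≡ 0 → (x : Fin a) → f x ≢ w
  fiberSize-zero⇒≢ f w fiber≡0 x refl = <-irrefl (sym fiber≡0) (fiberSize-image f x)

  fiberSize≤ : (f : Fin a → Fin b) (w : Fin b) → fiberSize f w ≤ a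
  fiberSize≤ f w = subst₂ _≤_ (sym (fiberSize≡∑ f w)) (trans (∑Fin-const a 1) (*-identityʳ a))
                          (∑-mono (allFin a) (λ u → χ-≤1 (f u == w)))

  fiberSizes : (Fin a → Fin b) → List ℕ
  fiberSizes f = positiveValues (fiberSize f)

  homType≡sort-fiberSizes : (f : Fin a → Fin b) → homType f ≡ sort (fiberSizes f)
  homType≡sort-fiberSizes f = cong (sort ∘ positives) (map-tabulate id (fiberSize f))

  homType-resp : (f g : Fin a → Fin b) → f ≗ g → homType f ≡ homType g
  homType-resp f g f≗g = trans (homType≡sort-fiberSizes f)
    (trans (cong (sort ∘ positives) (tabulate-cong (fiberSize-resp f g f≗g))) (sym (homType≡sort-fiberSizes g)))

  homType-↭ : (f : Fin a → Fin b) → fiberSizes f ↭ homType f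
  homType-↭ f = subst (fiberSizes f ↭_) (sym (homType≡sort-fiberSizes f)) (↭-sym (sort-↭ (fiberSizes f)))

  homType≡⇒↭ : (f : Fin a → Fin b) (λ′ : List ℕ) → homType f ≡ λ′ → fiberSizes f ↭ λ′
  homType≡⇒↭ f λ′ refl = homType-↭ f

  ↭⇒homType≡ : (f : Fin a → Fin b) (λ′ : List ℕ) → IsPartition λ′ → fiberSizes f ↭ λ′ → homType f ≡ λ′
  ↭⇒homType≡ f λ′ (λ′↗ , _) fibers↭λ′ = trans (homType≡sort-fiberSizes f)
    (Pointwise-≡⇒≡ (↗↭↗⇒≋ ≤-totalOrder (sort-↗ (fiberSizes f)) λ′↗ (↭⇒↭ₛ (↭-trans (sort-↭ (fiberSizes f)) fibers↭λ′))))

  homType-IsPartition : (f : Fin a → Fin b) → IsPartition (homType f)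
  homType-IsPartition f rewrite homType≡sort-fiberSizes f =
    sort-↗ (fiberSizes f) , All-resp-↭ (↭-sym (sort-↭ (fiberSizes f))) (All-positive-positives (tabulate (fiberSize f)))

  length-homType : (f : Fin a → Fin b) → length (homType f) ≤ b
  length-homType f rewrite homType≡sort-fiberSizes f =
    subst (_≤ b) (sym (↭-length (sort-↭ (fiberSizes f))))
          (≤-trans (Listₚ.length-filter (0 <?_) (tabulate (fiberSize f))) (≤-reflexive (length-tabulate (fiberSize f))))

  sum-homType : (f : Fin a → Fin b) → sum (homType f) ≡ a
  sum-homType f rewrite homType≡sort-fiberSizes f = begin
    sum (sort (fiberSizes f))            ≡⟨ sum-↭ (sort-↭ (fiberSizes f)) ⟩
    sum (fiberSizes f)                   ≡⟨ sum-positives (tabulate (fiberSize f)) ⟩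
    sum (tabulate (fiberSize f))         ≡⟨ sum-tabulate (fiberSize f) ⟩
    ∑Fin b (fiberSize f)                 ≡⟨ ∑-fiberSize f ⟩
    a                                    ∎

  length-fiberSizes : (f : Fin a → Fin b) → length (fiberSizes f) ≡ ∑Fin b (λ w → χ (does (0 <? fiberSize f w)))
  length-fiberSizes f = length-positiveValues (fiberSize f)

χ-positive : ∀ {k} → 0 < k → χ (does (0 <? k)) ≡ 1
χ-positive {k} 0<k rewrite dec-true (0 <? k) 0<k = refl

module _ {b : ℕ} (h : Fin b → ℕ) where

  private
    #positive : ℕ
    #positive = ∑Fin b (λ w → χ (does (0 <? h w)))
    δ : Fin b → Fin b → ℕ
    δ p w = χ (w == p) * 1

  two-positive : (p q : Fin b) → p ≢ q → 0 < h p → 0 < h q → 2 ≤ #positive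
  two-positive p q p≢q 0<hp 0<hq =
    subst (_≤ #positive) (trans (∑-+ (allFin b) _ _) (cong₂ _+_ (∑Fin-selectˡ b p _) (∑Fin-selectˡ b q _)))
          (∑-mono (allFin b) at-p-or-q)
    where
    at-p-or-q : ∀ w → δ p w + δ q w ≤ χ (does (0 <? h w))
    at-p-or-q w with w Finₚ.≟ p | w Finₚ.≟ q
    ... | yes refl | yes refl = ⊥-elim (p≢q refl)
    ... | yes refl | no _     = ≤-reflexive (sym (χ-positive 0<hp))
    ... | no _     | yes refl = ≤-reflexive (sym (χ-positive 0<hq))
    ... | no _     | no _     = z≤n

  three-positive : (p q r : Fin b) → p ≢ q → p ≢ r → q ≢ r → 0 < h p → 0 < h q → 0 < h r → 3 ≤ #positive
  three-positive p q r p≢q p≢r q≢r 0<hp 0<hq 0<hr =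
    subst (_≤ #positive)
          (trans (∑-+ (allFin b) _ _) (cong₂ _+_ (∑Fin-selectˡ b p _)
                 (trans (∑-+ (allFin b) _ _) (cong₂ _+_ (∑Fin-selectˡ b q _) (∑Fin-selectˡ b r _)))))
          (∑-mono (allFin b) at-p-q-or-r)
    where
    at-p-q-or-r : ∀ w → δ p w + (δ q w + δ r w) ≤ χ (does (0 <? h w))
    at-p-q-or-r w with w Finₚ.≟ p | w Finₚ.≟ q | w Finₚ.≟ r
    ... | yes refl | yes refl | _        = ⊥-elim (p≢q refl)
    ... | yes refl | no _     | yes refl = ⊥-elim (p≢r refl)
    ... | no _     | yes refl | yes refl = ⊥-elim (q≢r refl)
    ... | yes refl | no _     | no _     = ≤-reflexive (sym (χ-positive 0<hp))
    ... | no _     | yes refl | no _     = ≤-reflexive (sym (χ-positive 0<hq))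
    ... | no _     | no _     | yes refl = ≤-reflexive (sym (χ-positive 0<hr))
    ... | no _     | no _     | no _     = z≤n

module _ {a b : ℕ} (f : Fin a → Fin b) where

  separating⇒two-parts : (x₀ x₁ : Fin a) → f x₀ ≢ f x₁ → 2 ≤ length (fiberSizes f)
  separating⇒two-parts x₀ x₁ fx₀≢fx₁ = subst (2 ≤_) (sym (length-fiberSizes f))
    (two-positive (fiberSize f) (f x₀) (f x₁) fx₀≢fx₁ (fiberSize-image f x₀) (fiberSize-image f x₁))

  two-parts⇒image : (x₀ x₁ : Fin a) → f x₀ ≢ f x₁ → length (fiberSizes f) ≡ 2 → ∀ x → f x ≡ f x₀ ⊎ f x ≡ f x₁
  two-parts⇒image x₀ x₁ fx₀≢fx₁ two x with f x Finₚ.≟ f x₀ | f x Finₚ.≟ f x₁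
  ... | yes fx≡fx₀ | _          = inj₁ fx≡fx₀
  ... | no _       | yes fx≡fx₁ = inj₂ fx≡fx₁
  ... | no fx≢fx₀  | no fx≢fx₁  = ⊥-elim (<-irrefl refl (≤-trans
        (three-positive (fiberSize f) (f x₀) (f x₁) (f x) fx₀≢fx₁ (fx≢fx₀ ∘ sym) (fx≢fx₁ ∘ sym)
                        (fiberSize-image f x₀) (fiberSize-image f x₁) (fiberSize-image f x))
        (≤-reflexive (trans (sym (length-fiberSizes f)) two))))

fiberSizes-two-values : ∀ {a b} (f : Fin a → Fin b) {p q : Fin b} → p ≢ q → (∀ x → f x ≡ p ⊎ f x ≡ q) →
                        (x₀ x₁ : Fin a) → f x₀ ≡ p → f x₁ ≡ q → fiberSizes f ↭ fiberSize f p ∷ fiberSize f q ∷ []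
fiberSizes-two-values f {p} {q} p≢q p-or-q x₀ x₁ fx₀≡p fx₁≡q =
  positiveValues-pair (fiberSize f) p q p≢q
    (λ w w≢p w≢q → fiberSize-outside-image f w (λ x fx≡w → [ (λ fx≡p → w≢p (trans (sym fx≡w) fx≡p)) ,
                                                             (λ fx≡q → w≢q (trans (sym fx≡w) fx≡q)) ]′ (p-or-q x)))
    (subst (λ w → 0 < fiberSize f w) fx₀≡p (fiberSize-image f x₀))
    (subst (λ w → 0 < fiberSize f w) fx₁≡q (fiberSize-image f x₁))

-- Homomorphisms and K₂

module _ (G H : Graph) where

  isHom-sound : (f : Fin (n G) → Fin (n H)) → isHom G H f ≡ true →
                ∀ u v → adj G u v ≡ true → adj H (f u) (f v) ≡ true
  isHom-sound f hom u v uv with all-tabulate⁻ id _ (all-tabulate⁻ id _ hom u) v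
  ... | edge-or-not rewrite uv = edge-or-not

  isHom-complete : (f : Fin (n G) → Fin (n H)) → (∀ u v → adj G u v ≡ true → adj H (f u) (f v) ≡ true) →
                   isHom G H f ≡ true
  isHom-complete f preserves = all-tabulate⁺ id _ (λ u → all-tabulate⁺ id _ (λ v → edge-or-not u v))
    where
    edge-or-not : ∀ u v → not (adj G u v) ∨ adj H (f u) (f v) ≡ true
    edge-or-not u v with adj G u v in uv
    ... | false = refl
    ... | true  = preserves u v uv

  isHom-resp : Respects≗ (isHom G H)
  isHom-resp f g f≗g = all-cong (allFin (n G)) (λ u → all-cong (allFin (n G)) (λ v →
    cong₂ (λ x y → not (adj G u v) ∨ adj H x y) (f≗g u) (f≗g v)))

isHom-id : (G : Graph) → isHom G G id ≡ true
isHom-id G = isHom-complete G G id (λ u v uv → uv)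

adj-irrefl : (G : Graph) {u v : Fin (n G)} → adj G u v ≡ true → u ≢ v
adj-irrefl G {u} uv refl = false≢true (trans (sym (Graph.irrefl G u)) uv)

K₂ : Graph
K₂ = record { n = 2 ; adj = λ i j → not (i == j) ; sym = λ i j → cong not (==-sym i j) ; irrefl = λ i → cong not (==-refl i) }

K₂-adj : (i j : Fin 2) → i ≢ j → adj K₂ i j ≡ true
K₂-adj i j i≢j rewrite ≢⇒==false i≢j = refl

𝟘 𝟙 : Fin 2
𝟘 = zero
𝟙 = suc zero

𝟘≢𝟙 : 𝟘 ≢ 𝟙
𝟘≢𝟙 ()

_⊕_ : Fin 2 → Fin 2 → Fin 2
zero     ⊕ y        = y
suc zero ⊕ zero     = suc zero
suc zero ⊕ suc zero = zero

flip : Fin 2 → Fin 2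
flip = 𝟙 ⊕_

⊕-comm : ∀ x y → x ⊕ y ≡ y ⊕ x
⊕-comm zero       zero       = refl
⊕-comm zero       (suc zero) = refl
⊕-comm (suc zero) zero       = refl
⊕-comm (suc zero) (suc zero) = refl

⊕-cancelˡ : ∀ x y → x ⊕ (x ⊕ y) ≡ y
⊕-cancelˡ zero       y          = refl
⊕-cancelˡ (suc zero) zero       = refl
⊕-cancelˡ (suc zero) (suc zero) = refl

⊕-cancelʳ : ∀ x y → (x ⊕ y) ⊕ y ≡ x
⊕-cancelʳ x y = trans (⊕-comm (x ⊕ y) y) (trans (cong (y ⊕_) (⊕-comm x y)) (⊕-cancelˡ y x))

⊕-injective : ∀ c {x y} → c ⊕ x ≡ c ⊕ y → x ≡ y
⊕-injective c {x} {y} c⊕x≡c⊕y = trans (sym (⊕-cancelˡ c x)) (trans (cong (c ⊕_) c⊕x≡c⊕y) (⊕-cancelˡ c y))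

⊕-≢ : ∀ {a a′ c c′} → a ≢ a′ → c ≢ c′ → a ⊕ c ≡ a′ ⊕ c′
⊕-≢ {zero}     {zero}     a≢a′ _    = ⊥-elim (a≢a′ refl)
⊕-≢ {suc zero} {suc zero} a≢a′ _    = ⊥-elim (a≢a′ refl)
⊕-≢ {c = zero}     {zero}     _ c≢c′ = ⊥-elim (c≢c′ refl)
⊕-≢ {c = suc zero} {suc zero} _ c≢c′ = ⊥-elim (c≢c′ refl)
⊕-≢ {zero}     {suc zero} {zero}     {suc zero} _ _ = refl
⊕-≢ {zero}     {suc zero} {suc zero} {zero}     _ _ = refl
⊕-≢ {suc zero} {zero}     {zero}     {suc zero} _ _ = refl
⊕-≢ {suc zero} {zero}     {suc zero} {zero}     _ _ = refl

flip-involutive : ∀ x → flip (flip x) ≡ x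
flip-involutive = ⊕-cancelˡ 𝟙

flip-injective : ∀ {x y} → flip x ≡ flip y → x ≡ y
flip-injective = ⊕-injective 𝟙

flip-==𝟘 : ∀ y → (flip y == 𝟘) ≡ (y == 𝟙)
flip-==𝟘 zero       = refl
flip-==𝟘 (suc zero) = refl

flip-==𝟙 : ∀ y → (flip y == 𝟙) ≡ (y == 𝟘)
flip-==𝟙 zero       = refl
flip-==𝟙 (suc zero) = refl

⊕-==𝟘 : ∀ y s → ((y ⊕ s) == 𝟘) ≡ (y == s)
⊕-==𝟘 zero       zero       = refl
⊕-==𝟘 zero       (suc zero) = refl
⊕-==𝟘 (suc zero) zero       = refl
⊕-==𝟘 (suc zero) (suc zero) = refl

fiberSize-𝟘+𝟙 : ∀ {a} (g : Fin a → Fin 2) → fiberSize g 𝟘 + fiberSize g 𝟙 ≡ a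
fiberSize-𝟘+𝟙 g = trans (cong (fiberSize g 𝟘 +_) (sym (+-identityʳ _))) (∑-fiberSize g)

fiberSize-𝟙 : ∀ {a} (g : Fin a → Fin 2) → fiberSize g 𝟙 ≡ a ∸ fiberSize g 𝟘
fiberSize-𝟙 g = trans (sym (m+n∸m≡n (fiberSize g 𝟘) (fiberSize g 𝟙))) (cong (_∸ fiberSize g 𝟘) (fiberSize-𝟘+𝟙 g))

pick : Fin 2 → ℕ → ℕ → ℕ
pick zero       t f = t
pick (suc zero) t f = f

VanishesOff : ∀ {a} → (Fin a → Bool) → (Fin a → Fin 2) → Bool
VanishesOff {a} R σ = all (λ i → R i ∨ (σ i == 𝟘)) (allFin a)

weight : ∀ {a} → (Fin a → Bool) → (Fin a → ℕ) → (Fin a → ℕ) → (Fin a → Fin 2) → ℕ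
weight {a} R w₀ w₁ σ = ∑Fin a (λ i → if R i then pick (σ i) (w₀ i) (w₁ i) else 0)

selectedPairs : ∀ {a} → (Fin a → Bool) → (Fin a → ℕ) → (Fin a → ℕ) → List (ℕ × ℕ)
selectedPairs {zero}  R w₀ w₁ = []
selectedPairs {suc a} R w₀ w₁ = if R zero then (w₀ zero , w₁ zero) ∷ rest else rest
  where
  rest : List (ℕ × ℕ)
  rest = selectedPairs (R ∘ suc) (w₀ ∘ suc) (w₁ ∘ suc)

all-allFin-suc : ∀ {a} (p : Fin (suc a) → Bool) → all p (allFin (suc a)) ≡ p zero ∧ all (p ∘ suc) (allFin a)
all-allFin-suc {a} p = cong (λ bs → p zero ∧ and bs)
                            (trans (map-tabulate suc p) (sym (map-tabulate id (p ∘ suc))))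

∑Maps-VanishesOff≡choiceCount : ∀ {a} (R : Fin a → Bool) (w₀ w₁ : Fin a → ℕ) (C : ℕ → Bool) →
  ∑Maps a 2 (λ σ → χ (VanishesOff R σ ∧ C (weight R w₀ w₁ σ))) ≡ choiceCount (selectedPairs R w₀ w₁) C
∑Maps-VanishesOff≡choiceCount {zero}  R w₀ w₁ C = +-identityʳ _
∑Maps-VanishesOff≡choiceCount {suc a} R w₀ w₁ C =
  trans (∑Maps-suc a 2 _) (trans (∑-cong (allMaps a 2) split-head) (by-head (R zero) refl))
  where
  R′ : Fin a → Bool
  R′  = R ∘ suc
  w₀′ w₁′ : Fin a → ℕ
  w₀′ = w₀ ∘ suc
  w₁′ = w₁ ∘ suc
  head : Fin 2 → ℕ
  head x = if R zero then pick x (w₀ zero) (w₁ zero) else 0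
  split-head : ∀ τ → ∑Fin 2 (λ x → χ (VanishesOff R (x ∷ᶠ τ) ∧ C (weight R w₀ w₁ (x ∷ᶠ τ))))
                   ≡ ∑Fin 2 (λ x → χ (((R zero ∨ (x == 𝟘)) ∧ VanishesOff R′ τ) ∧ C (head x + weight R′ w₀′ w₁′ τ)))
  split-head τ = ∑-cong (allFin 2) (λ x → cong χ (cong₂ _∧_
    (all-allFin-suc {a} (λ i → R i ∨ ((x ∷ᶠ τ) i == 𝟘)))
    (cong C (∑Fin-suc a (λ i → if R i then pick ((x ∷ᶠ τ) i) (w₀ i) (w₁ i) else 0)))))
  by-head : (r : Bool) → R zero ≡ r →
    ∑Maps a 2 (λ τ → ∑Fin 2 (λ x → χ (((R zero ∨ (x == 𝟘)) ∧ VanishesOff R′ τ) ∧ C (head x + weight R′ w₀′ w₁′ τ))))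
      ≡ choiceCount (selectedPairs R w₀ w₁) C
  by-head true R0 rewrite R0 =
    trans (∑-cong (allMaps a 2) (λ τ → cong (χ (VanishesOff R′ τ ∧ C (w₀ zero + weight R′ w₀′ w₁′ τ)) +_) (+-identityʳ _)))
          (trans (∑-+ (allMaps a 2) _ _)
                 (cong₂ _+_ (∑Maps-VanishesOff≡choiceCount R′ w₀′ w₁′ (C ∘ (w₀ zero +_)))
                            (∑Maps-VanishesOff≡choiceCount R′ w₀′ w₁′ (C ∘ (w₁ zero +_)))))
  by-head false R0 rewrite R0 =
    trans (∑-cong (allMaps a 2) (λ τ → +-identityʳ _)) (∑Maps-VanishesOff≡choiceCount R′ w₀′ w₁′ C)

map-filterᵇ≡selectedPairs : ∀ {a} {Y : Set} (f : Fin a → Y) (R : Y → Bool) (w₀ w₁ : Y → ℕ) →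
  map (λ r → (w₀ r , w₁ r)) (filterᵇ R (tabulate f)) ≡ selectedPairs (R ∘ f) (w₀ ∘ f) (w₁ ∘ f)
map-filterᵇ≡selectedPairs {zero}  f R w₀ w₁ = refl
map-filterᵇ≡selectedPairs {suc a} f R w₀ w₁ with R (f zero)
... | true  = cong ((w₀ (f zero) , w₁ (f zero)) ∷_) (map-filterᵇ≡selectedPairs (f ∘ suc) R w₀ w₁)
... | false = map-filterᵇ≡selectedPairs (f ∘ suc) R w₀ w₁

-- Proper 2-colourings of a bipartite graph

module Colourings (G : Graph) (b : Bipartite G) where

  open Connectivity G public

  colour : V → Bool
  colour = proj₁ b

  side : V → Fin 2
  side x = if colour x then 𝟙 else 𝟘

  side-proper : ∀ u v → adj G u v ≡ true → side u ≢ side v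
  side-proper u v uv side≡ = proj₂ b u v uv (if-injective (colour u) (colour v) side≡)
    where
    if-injective : ∀ x y → (if x then 𝟙 else 𝟘) ≡ (if y then 𝟙 else 𝟘) → x ≡ y
    if-injective true  true  _ = refl
    if-injective false false _ = refl

  Proper : (V → Fin 2) → Bool
  Proper = isHom G K₂

  Proper-≢ : (g : V → Fin 2) → Proper g ≡ true → ∀ u v → adj G u v ≡ true → g u ≢ g v
  Proper-≢ g proper u v uv gu≡gv =
    false≢true (trans (sym (cong not (trans (cong (g u ==_) (sym gu≡gv)) (==-refl (g u))))) (isHom-sound G K₂ g proper u v uv))

  Proper-intro : (g : V → Fin 2) → (∀ u v → adj G u v ≡ true → g u ≢ g v) → Proper g ≡ true
  Proper-intro g proper = isHom-complete G K₂ g (λ u v uv → K₂-adj (g u) (g v) (proper u v uv))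

  Proper-relative-constant : (g : V → Fin 2) → Proper g ≡ true →
                             ∀ u v → connected G u v ≡ true → g u ⊕ side u ≡ g v ⊕ side v
  Proper-relative-constant g proper =
    connected-invariant (λ x → g x ⊕ side x) (λ w v wv → ⊕-≢ (Proper-≢ g proper w v wv) (side-proper w v wv))

  part₀ part₁ : V → ℕ
  part₀ r = ∑Fin N (λ x → χ (rep x == r) * χ (side x == 𝟘))
  part₁ r = ∑Fin N (λ x → χ (rep x == r) * χ (side x == 𝟙))

  sidePairs : List (ℕ × ℕ)
  sidePairs = selectedPairs (isRep G) part₀ part₁

  flipWeight : (V → Fin 2) → ℕ
  flipWeight = weight (isRep G) part₀ part₁

  -- A proper colouring is determined by which components are coloured against the bipartition;
  -- this is recorded at the representatives.
  toFlips : (V → Fin 2) → (V → Fin 2)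
  toFlips g x = if isRep G x then g x ⊕ side x else 𝟘

  fromFlips : (V → Fin 2) → (V → Fin 2)
  fromFlips σ x = side x ⊕ σ (rep x)

  fiberSize-fromFlips : (σ : V → Fin 2) → fiberSize (fromFlips σ) 𝟘 ≡ flipWeight σ
  fiberSize-fromFlips σ = begin
    fiberSize (fromFlips σ) 𝟘
      ≡⟨ fiberSize≡∑ (fromFlips σ) 𝟘 ⟩
    ∑Fin N (λ x → χ (fromFlips σ x == 𝟘))
      ≡⟨ ∑-cong (allFin N) (λ x → sym (∑Fin-selectʳ N (rep x) (λ _ → χ (fromFlips σ x == 𝟘)))) ⟩
    ∑Fin N (λ x → ∑Fin N (λ r → χ (rep x == r) * χ (fromFlips σ x == 𝟘)))
      ≡⟨ ∑-swap (allFin N) (allFin N) _ ⟩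
    ∑Fin N (λ r → ∑Fin N (λ x → χ (rep x == r) * χ (fromFlips σ x == 𝟘)))
      ≡⟨ ∑-cong (allFin N) component ⟩
    flipWeight σ ∎
    where
    in-component : ∀ r x → χ (rep x == r) * χ (fromFlips σ x == 𝟘) ≡ χ (rep x == r) * χ (side x == σ r)
    in-component r x with rep x Finₚ.≟ r
    ... | yes refl = cong (1 *_) (cong χ (⊕-==𝟘 (side x) (σ (rep x))))
    ... | no _     = refl
    part : ∀ r s → ∑Fin N (λ x → χ (rep x == r) * χ (side x == s)) ≡ pick s (part₀ r) (part₁ r)
    part r zero       = refl
    part r (suc zero) = refl
    component : ∀ r → ∑Fin N (λ x → χ (rep x == r) * χ (fromFlips σ x == 𝟘))
                      ≡ (if isRep G r then pick (σ r) (part₀ r) (part₁ r) else 0)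
    component r with isRep G r in r-rep
    ... | true  = trans (∑-cong (allFin N) (in-component r)) (part r (σ r))
    ... | false = trans (∑-cong (allFin N) not-rep) (∑-zero (allFin N))
      where
      not-rep : ∀ x → χ (rep x == r) * χ (fromFlips σ x == 𝟘) ≡ 0
      not-rep x with rep x Finₚ.≟ r
      ... | yes refl = ⊥-elim (false≢true (trans (sym r-rep) (rep-isRep x)))
      ... | no _     = refl

  fromFlips∘toFlips : (g : V → Fin 2) → Proper g ≡ true → fromFlips (toFlips g) ≗ g
  fromFlips∘toFlips g proper x = begin
    side x ⊕ toFlips g (rep x)              ≡⟨ cong (λ t → side x ⊕ (if t then g (rep x) ⊕ side (rep x) else 𝟘)) (rep-isRep x) ⟩
    side x ⊕ (g (rep x) ⊕ side (rep x))     ≡⟨ cong (side x ⊕_) (Proper-relative-constant g proper (rep x) x (rep-connected x)) ⟩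
    side x ⊕ (g x ⊕ side x)                 ≡⟨ cong (side x ⊕_) (⊕-comm (g x) (side x)) ⟩
    side x ⊕ (side x ⊕ g x)                 ≡⟨ ⊕-cancelˡ (side x) (g x) ⟩
    g x                                     ∎

  toFlips∘fromFlips : (σ : V → Fin 2) → VanishesOff (isRep G) σ ≡ true → toFlips (fromFlips σ) ≗ σ
  toFlips∘fromFlips σ vanishes i = by-rep (isRep G i) refl
    where
    by-rep : (t : Bool) → isRep G i ≡ t → toFlips (fromFlips σ) i ≡ σ i
    by-rep true  i-rep = begin
      toFlips (fromFlips σ) i        ≡⟨ cong (λ t → if t then fromFlips σ i ⊕ side i else 𝟘) i-rep ⟩
      (side i ⊕ σ (rep i)) ⊕ side i  ≡⟨ cong (λ r → (side i ⊕ σ r) ⊕ side i) (rep-fixes-isRep i i-rep) ⟩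
      (side i ⊕ σ i) ⊕ side i        ≡⟨ cong (_⊕ side i) (⊕-comm (side i) (σ i)) ⟩
      (σ i ⊕ side i) ⊕ side i        ≡⟨ ⊕-cancelʳ (σ i) (side i) ⟩
      σ i                            ∎
    by-rep false i-rep = trans (cong (λ t → if t then fromFlips σ i ⊕ side i else 𝟘) i-rep)
      (sym (==⇒≡ (trans (sym (cong (_∨ (σ i == 𝟘)) i-rep)) (all-tabulate⁻ id _ vanishes i))))

  fromFlips-Proper : (σ : V → Fin 2) → Proper (fromFlips σ) ≡ true
  fromFlips-Proper σ = Proper-intro (fromFlips σ) (λ u v uv same → side-proper u v uv (⊕-injective (σ (rep u)) (begin
    σ (rep u) ⊕ side u  ≡⟨ ⊕-comm (σ (rep u)) (side u) ⟩
    side u ⊕ σ (rep u)  ≡⟨ same ⟩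
    side v ⊕ σ (rep v)  ≡⟨ cong (λ r → side v ⊕ σ r) (rep-adj u v uv) ⟨
    side v ⊕ σ (rep u)  ≡⟨ ⊕-comm (side v) (σ (rep u)) ⟩
    σ (rep u) ⊕ side v  ∎)))

  toFlips-VanishesOff : (g : V → Fin 2) → VanishesOff (isRep G) (toFlips g) ≡ true
  toFlips-VanishesOff g = all-tabulate⁺ id _ vanishes
    where
    vanishes : ∀ i → isRep G i ∨ (toFlips g i == 𝟘) ≡ true
    vanishes i with isRep G i
    ... | true  = refl
    ... | false = refl

  ProperWith : (ℕ → Bool) → (V → Fin 2) → Bool
  ProperWith C g = Proper g ∧ C (fiberSize g 𝟘)

  ProperWith-resp : (C : ℕ → Bool) → Respects≗ (ProperWith C)
  ProperWith-resp C f g f≗g = cong₂ _∧_ (isHom-resp G K₂ f g f≗g) (cong C (fiberSize-resp f g f≗g 𝟘))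

  #Proper : (ℕ → Bool) → ℕ
  #Proper C = ∑Maps N 2 (χ ∘ ProperWith C)

  #Proper≡choiceCount : (C : ℕ → Bool) → #Proper C ≡ choiceCount sidePairs C
  #Proper≡choiceCount C =
    trans (∑Maps-bijection (ProperWith-resp C) Flips-resp toFlips fromFlips
             (λ f g f≗g x → cong (λ y → if isRep G x then y ⊕ side x else 𝟘) (f≗g x))
             (λ f g f≗g x → cong (side x ⊕_) (f≗g (rep x)))
             to-maps from-maps
             (λ g Pg → fromFlips∘toFlips g (proj₁ (∧-true⁻ _ _ Pg)))
             (λ σ Qσ → toFlips∘fromFlips σ (proj₁ (∧-true⁻ _ _ Qσ))))
          (∑Maps-VanishesOff≡choiceCount (isRep G) part₀ part₁ C)
    where
    FlipsWith : (V → Fin 2) → Bool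
    FlipsWith σ = VanishesOff (isRep G) σ ∧ C (flipWeight σ)
    Flips-resp : Respects≗ FlipsWith
    Flips-resp f g f≗g = cong₂ _∧_
      (all-cong (allFin N) (λ i → cong (λ y → isRep G i ∨ (y == 𝟘)) (f≗g i)))
      (cong C (∑-cong (allFin N) (λ i → cong (λ y → if isRep G i then pick y (part₀ i) (part₁ i) else 0) (f≗g i))))
    to-maps : ∀ g → ProperWith C g ≡ true → FlipsWith (toFlips g) ≡ true
    to-maps g Pg with ∧-true⁻ _ _ Pg
    ... | proper , Cg = ∧-true⁺ (toFlips-VanishesOff g)
      (trans (cong C (trans (sym (fiberSize-fromFlips (toFlips g))) (fiberSize-resp _ _ (fromFlips∘toFlips g proper) 𝟘))) Cg)
    from-maps : ∀ σ → FlipsWith σ ≡ true → ProperWith C (fromFlips σ) ≡ true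
    from-maps σ Qσ = ∧-true⁺ (fromFlips-Proper σ) (trans (cong C (fiberSize-fromFlips σ)) (proj₂ (∧-true⁻ _ _ Qσ)))

  compDiff≡gap : (r : V) → isRep G r ≡ true → compDiff G b r ≡ gap (part₀ r , part₁ r)
  compDiff≡gap r r-rep = trans (cong₂ ∣_-_∣ (count true) (count false)) (∣-∣-comm (part₁ r) (part₀ r))
    where
    connected≡rep== : ∀ u → connected G r u ≡ (rep u == r)
    connected≡rep== u with connected G r u in ru | rep u Finₚ.≟ r
    ... | true  | yes _      = refl
    ... | false | no _       = refl
    ... | true  | no rep≢r   = ⊥-elim (rep≢r (rep-unique r u r-rep ru))
    ... | false | yes rep≡r  = ⊥-elim (false≢true (trans (sym ru) (rep≡⇒connected r u rep≡r)))
    onSide : Bool → V → Bool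
    onSide t u = if t then colour u else not (colour u)
    termwise : ∀ t u → χ (connected G r u ∧ onSide t u) ≡ χ (rep u == r) * χ (side u == (if t then 𝟙 else 𝟘))
    termwise t u rewrite connected≡rep== u with rep u == r
    ... | false = refl
    ... | true with colour u | t
    ...   | true  | true  = refl
    ...   | true  | false = refl
    ...   | false | true  = refl
    ...   | false | false = refl
    count : ∀ t → length (filterᵇ (λ u → connected G r u ∧ onSide t u) (allFin N))
                  ≡ ∑Fin N (λ x → χ (rep x == r) * χ (side x == (if t then 𝟙 else 𝟘)))
    count t = trans (length-filterᵇ _ (allFin N)) (∑-cong (allFin N) (termwise t))

  nonzeroDiffs≡positive-gaps : nonzeroDiffs G b ≡ positives (map gap sidePairs)
  nonzeroDiffs≡positive-gaps = cong positives (begin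
    map (compDiff G b) (filterᵇ (isRep G) (allFin N))
      ≡⟨ map-filterᵇ-cong (isRep G) compDiff≡gap (allFin N) ⟩
    map (λ r → gap (part₀ r , part₁ r)) (filterᵇ (isRep G) (allFin N))
      ≡⟨ map-∘ (filterᵇ (isRep G) (allFin N)) ⟩
    map gap (map (λ r → (part₀ r , part₁ r)) (filterᵇ (isRep G) (allFin N)))
      ≡⟨ cong (map gap) (map-filterᵇ≡selectedPairs id (isRep G) part₀ part₁) ⟩
    map gap sidePairs ∎)
    where
    map-filterᵇ-cong : {X Y : Set} (R : X → Bool) {f g : X → Y} → (∀ x → R x ≡ true → f x ≡ g x) →
                       (xs : List X) → map f (filterᵇ R xs) ≡ map g (filterᵇ R xs)
    map-filterᵇ-cong R f≗g []       = refl
    map-filterᵇ-cong R f≗g (x ∷ xs) with R x in Rx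
    ... | true  = cong₂ _∷_ (f≗g x Rx) (map-filterᵇ-cong R f≗g xs)
    ... | false = map-filterᵇ-cong R f≗g xs

  flipAll : (V → Fin 2) → (V → Fin 2)
  flipAll g = flip ∘ g

  flipAll-Proper : (g : V → Fin 2) → Proper g ≡ true → Proper (flipAll g) ≡ true
  flipAll-Proper g proper = Proper-intro (flipAll g) (λ u v uv → Proper-≢ g proper u v uv ∘ flip-injective)

  fiberSize-flipAll : (g : V → Fin 2) → fiberSize (flipAll g) 𝟘 ≡ fiberSize g 𝟙
  fiberSize-flipAll g = trans (fiberSize≡∑ (flipAll g) 𝟘)
    (trans (∑-cong (allFin N) (λ x → cong χ (flip-==𝟘 (g x)))) (sym (fiberSize≡∑ g 𝟙)))

  flipAll-resp : ∀ f g → f ≗ g → flipAll f ≗ flipAll g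
  flipAll-resp f g f≗g = cong flip ∘ f≗g

  flipAll-involutive : ∀ g → flipAll (flipAll g) ≗ g
  flipAll-involutive g = flip-involutive ∘ g

  #Proper-cong≤N : (C C′ : ℕ → Bool) → (∀ k → k ≤ N → C k ≡ C′ k) → #Proper C ≡ #Proper C′
  #Proper-cong≤N C C′ C≗C′ = ∑-cong (allMaps N 2) (λ g → cong (λ t → χ (Proper g ∧ t)) (C≗C′ _ (fiberSize≤ g 𝟘)))

  #Proper-false≤N : (C : ℕ → Bool) → (∀ k → k ≤ N → C k ≡ false) → #Proper C ≡ 0
  #Proper-false≤N C C≡f = ∑-χ-false (allMaps N 2) (λ g → trans (cong (Proper g ∧_) (C≡f _ (fiberSize≤ g 𝟘))) (Boolₚ.∧-zeroʳ _))

  #Proper-complement : (C : ℕ → Bool) → #Proper C ≡ #Proper (λ k → C (N ∸ k))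
  #Proper-complement C = ∑Maps-bijection (ProperWith-resp C) (ProperWith-resp C′) flipAll flipAll
    flipAll-resp flipAll-resp to-maps from-maps (λ g _ → flipAll-involutive g) (λ g _ → flipAll-involutive g)
    where
    C′ : ℕ → Bool
    C′ k = C (N ∸ k)
    to-maps : ∀ g → ProperWith C g ≡ true → ProperWith C′ (flipAll g) ≡ true
    to-maps g Pg with ∧-true⁻ _ _ Pg
    ... | proper , Cg = ∧-true⁺ (flipAll-Proper g proper) (begin
      C (N ∸ fiberSize (flipAll g) 𝟘) ≡⟨ cong (λ k → C (N ∸ k)) (trans (fiberSize-flipAll g) (fiberSize-𝟙 g)) ⟩
      C (N ∸ (N ∸ fiberSize g 𝟘))     ≡⟨ cong C (m∸[m∸n]≡n (fiberSize≤ g 𝟘)) ⟩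
      C (fiberSize g 𝟘)               ≡⟨ Cg ⟩
      true                            ∎)
    from-maps : ∀ g → ProperWith C′ g ≡ true → ProperWith C (flipAll g) ≡ true
    from-maps g Pg with ∧-true⁻ _ _ Pg
    ... | proper , Cg = ∧-true⁺ (flipAll-Proper g proper) (trans (cong C (trans (fiberSize-flipAll g) (fiberSize-𝟙 g))) Cg)

  #ProperAt : ℕ → ℕ
  #ProperAt s = #Proper (λ k → does (k ≟ s))

  #ProperAt≡choiceCountAt : ∀ s → #ProperAt s ≡ choiceCountAt sidePairs s
  #ProperAt≡choiceCountAt s = #Proper≡choiceCount (λ k → does (k ≟ s))

  #ProperAt-beyond : ∀ s → N < s → #ProperAt s ≡ 0
  #ProperAt-beyond s N<s = #Proper-false≤N _ (λ k k≤N → dec-false (k ≟ s) (λ k≡s → <-irrefl refl (<-≤-trans N<s (subst (_≤ N) k≡s k≤N))))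

  #ProperAt-palindromic : ∀ s → s ≤ N → #ProperAt s ≡ #ProperAt (N ∸ s)
  #ProperAt-palindromic s s≤N = trans (#Proper-complement (λ k → does (k ≟ s))) (#Proper-cong≤N _ _ (λ k k≤N →
    does-⇔ (mk⇔ (λ N∸k≡s → trans (sym (m∸[m∸n]≡n k≤N)) (cong (N ∸_) N∸k≡s))
                (λ k≡N∸s → trans (cong (N ∸_) k≡N∸s) (m∸[m∸n]≡n s≤N)))
           (N ∸ k ≟ s) (k ≟ N ∸ s)))

  #ProperAt-0 : {x₀ x₁ : V} → adj G x₀ x₁ ≡ true → #ProperAt 0 ≡ 0
  #ProperAt-0 {x₀} {x₁} x₀x₁ = ∑-χ-false (allMaps N 2) (λ g → not-both g (Proper g) (does (fiberSize g 𝟘 ≟ 0)) refl refl)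
    where
    not-𝟘 : ∀ y → y ≢ 𝟘 → y ≡ 𝟙
    not-𝟘 zero       y≢𝟘 = ⊥-elim (y≢𝟘 refl)
    not-𝟘 (suc zero) _   = refl
    not-both : ∀ g p e → Proper g ≡ p → does (fiberSize g 𝟘 ≟ 0) ≡ e → p ∧ e ≡ false
    not-both g false _     _      _     = refl
    not-both g true  false _      _     = refl
    not-both g true  true  proper empty = ⊥-elim (Proper-≢ g proper x₀ x₁ x₀x₁ (trans (not-𝟘 (g x₀) (missing x₀)) (sym (not-𝟘 (g x₁) (missing x₁)))))
      where
      missing : ∀ x → g x ≢ 𝟘
      missing = fiberSize-zero⇒≢ g 𝟘 (does-true⇒ (fiberSize g 𝟘 ≟ 0) empty)

  #Proper-∨ : (C₁ C₂ : ℕ → Bool) → (∀ k → C₁ k ≡ true → C₂ k ≡ true → ⊥) →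
              #Proper (λ k → C₁ k ∨ C₂ k) ≡ #Proper C₁ + #Proper C₂
  #Proper-∨ C₁ C₂ disjoint = trans (∑-cong (allMaps N 2) (λ g → χ-∧-∨ (Proper g) (C₁ _) (C₂ _) (disjoint _)))
                                   (∑-+ (allMaps N 2) _ _)
    where
    χ-∧-∨ : ∀ p x y → (x ≡ true → y ≡ true → ⊥) → χ (p ∧ (x ∨ y)) ≡ χ (p ∧ x) + χ (p ∧ y)
    χ-∧-∨ false x     y     _        = refl
    χ-∧-∨ true  true  true  disjoint = ⊥-elim (disjoint refl refl)
    χ-∧-∨ true  true  false _        = refl
    χ-∧-∨ true  false y     _        = refl

-- Homomorphisms of type (a, c)

HomOfType : (G H : Graph) (λ′ : List ℕ) → (Fin (n G) → Fin (n H)) → Bool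
HomOfType G H λ′ f = isHom G H f ∧ does (≡-dec _≟_ (homType f) λ′)

HomOfType-resp : (G H : Graph) (λ′ : List ℕ) → Respects≗ (HomOfType G H λ′)
HomOfType-resp G H λ′ f g f≗g =
  cong₂ _∧_ (isHom-resp G H f g f≗g) (cong (λ t → does (≡-dec _≟_ t λ′)) (homType-resp f g f≗g))

homCount≡∑ : (G H : Graph) (λ′ : List ℕ) → homCount G H λ′ ≡ ∑Maps (n G) (n H) (χ ∘ HomOfType G H λ′)
homCount≡∑ G H λ′ = length-filterᵇ (HomOfType G H λ′) (allMaps (n G) (n H))

#arcs : Graph → ℕ
#arcs G = ∑Fin (n G) (λ p → ∑Fin (n G) (λ q → χ (adj G p q)))

#arcs-positive : (G : Graph) {x₀ x₁ : Fin (n G)} → adj G x₀ x₁ ≡ true → 0 < #arcs G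
#arcs-positive G {x₀} {x₁} x₀x₁ = ≤-trans (≤-reflexive (cong χ (sym x₀x₁)))
  (≤-trans (∑Fin-term≤ (n G) (λ q → χ (adj G x₀ q)) x₁) (∑Fin-term≤ (n G) (λ p → ∑Fin (n G) (λ q → χ (adj G p q))) x₀))

multiplicity : ℕ → ℕ → ℕ
multiplicity a c = if does (a ≟ c) then 1 else 2

multiplicity-nonZero : ∀ a c → NonZero (multiplicity a c)
multiplicity-nonZero a c with does (a ≟ c)
... | true  = _
... | false = _

twoParts : ℕ → ℕ → List ℕ
twoParts a c = a ∷ c ∷ []

twoParts-IsPartition : ∀ {a c} → 0 < a → a ≤ c → IsPartition (twoParts a c)
twoParts-IsPartition 0<a a≤c = (a≤c ∷ [-]) , (0<a ∷ <-≤-trans 0<a a≤c ∷ [])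

module TwoPartHoms (G : Graph) (b : Bipartite G) {x₀ x₁ : Fin (n G)} (x₀x₁ : adj G x₀ x₁ ≡ true)
                   (a c : ℕ) (0<a : 0 < a) (a≤c : a ≤ c) (a+c≡N : a + c ≡ n G) where

  open Colourings G b

  InParts : ℕ → Bool
  InParts k = does (k ≟ a) ∨ does (k ≟ c)

  InParts-complement : ∀ x y → x + y ≡ a + c → InParts x ≡ InParts y
  InParts-complement x y x+y≡a+c =
    trans (cong₂ _∨_ (does-⇔ (mk⇔ (λ x≡a → +-cancelˡ-≡ a y c (trans (cong (_+ y) (sym x≡a)) x+y≡a+c))
                                   (λ y≡c → +-cancelʳ-≡ c x a (trans (cong (x +_) (sym y≡c)) x+y≡a+c)))
                              (x ≟ a) (y ≟ c))
                     (does-⇔ (mk⇔ (λ x≡c → +-cancelˡ-≡ c y a (trans (cong (_+ y) (sym x≡c)) x+y≡c+a))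
                                   (λ y≡a → +-cancelʳ-≡ a x c (trans (cong (x +_) (sym y≡a)) x+y≡c+a)))
                              (x ≟ c) (y ≟ a)))
          (Boolₚ.∨-comm (does (y ≟ c)) (does (y ≟ a)))
    where
    x+y≡c+a : x + y ≡ c + a
    x+y≡c+a = trans x+y≡a+c (+-comm a c)

  InParts⇒↭ : ∀ x y → x + y ≡ a + c → InParts x ≡ true → x ∷ y ∷ [] ↭ twoParts a c
  InParts⇒↭ x y x+y≡a+c x-in with x ≟ a
  ... | yes refl rewrite +-cancelˡ-≡ x y c x+y≡a+c = ↭-refl
  ... | no x≢a with x ≟ c
  ...   | yes refl rewrite +-cancelˡ-≡ x y a (trans x+y≡a+c (+-comm a x)) = ↭-swap x a ↭-refl
  ...   | no x≢c = ⊥-elim (false≢true (trans (sym (cong₂ _∨_ (dec-false (x ≟ a) x≢a) (dec-false (x ≟ c) x≢c))) x-in))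

  ↭⇒InParts : ∀ x y → x ∷ y ∷ [] ↭ twoParts a c → InParts x ≡ true
  ↭⇒InParts x y xy↭ac with ∈-resp-↭ xy↭ac (here refl)
  ... | here x≡a         rewrite x≡a = ∨-true⁺ˡ _ (dec-true (a ≟ a) refl)
  ... | there (here x≡c) rewrite x≡c = ∨-true⁺ʳ _ (dec-true (c ≟ c) refl)

  OfType : (V → V) → Bool
  OfType = HomOfType G G (twoParts a c)

  RootedAt : Fin 2 → (V → Fin 2) → Bool
  RootedAt i g = Proper g ∧ ((g x₀ == i) ∧ InParts (fiberSize g 𝟘))

  RootedAt-resp : ∀ i → Respects≗ (RootedAt i)
  RootedAt-resp i f g f≗g = cong₂ _∧_ (isHom-resp G K₂ f g f≗g)
    (cong₂ _∧_ (cong (_== i) (f≗g x₀)) (cong InParts (fiberSize-resp f g f≗g 𝟘)))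

  #Rooted : ℕ
  #Rooted = ∑Maps N 2 (χ ∘ RootedAt 𝟘)

  module Through {p q : V} (pq : adj G p q ≡ true) where

    p≢q : p ≢ q
    p≢q = adj-irrefl G pq

    HomThrough : (V → V) → Bool
    HomThrough f = (f x₁ == q) ∧ ((f x₀ == p) ∧ OfType f)

    onEdge : Fin 2 → V
    onEdge zero       = p
    onEdge (suc zero) = q

    spread : (V → Fin 2) → (V → V)
    spread g = onEdge ∘ g

    collapse : (V → V) → (V → Fin 2)
    collapse f x = if f x == p then 𝟘 else 𝟙

    collapse-p : ∀ f x → f x ≡ p → collapse f x ≡ 𝟘
    collapse-p f x fx≡p rewrite fx≡p | ==-refl p = refl

    collapse-q : ∀ f x → f x ≡ q → collapse f x ≡ 𝟙
    collapse-q f x fx≡q rewrite fx≡q | ≢⇒==false (p≢q ∘ sym) = refl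

    module _ (f : V → V) (through : HomThrough f ≡ true) where

      private
        x₀↦p∧hom : (f x₀ == p) ∧ OfType f ≡ true
        x₀↦p∧hom = proj₂ (∧-true⁻ (f x₁ == q) _ through)
        hom∧type : OfType f ≡ true
        hom∧type = proj₂ (∧-true⁻ (f x₀ == p) _ x₀↦p∧hom)
        fx₀≡p : f x₀ ≡ p
        fx₀≡p = ==⇒≡ {x = f x₀} {p} (proj₁ (∧-true⁻ _ _ x₀↦p∧hom))
        fx₁≡q : f x₁ ≡ q
        fx₁≡q = ==⇒≡ {x = f x₁} {q} (proj₁ (∧-true⁻ _ _ through))
        hom : isHom G G f ≡ true
        hom = proj₁ (∧-true⁻ (isHom G G f) _ hom∧type)
        type≡ : homType f ≡ twoParts a c
        type≡ = does-true⇒ (≡-dec _≟_ (homType f) (twoParts a c)) (proj₂ (∧-true⁻ (isHom G G f) _ hom∧type))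

      HomThrough-image : ∀ x → f x ≡ p ⊎ f x ≡ q
      HomThrough-image x with two-parts⇒image f x₀ x₁ (λ fx₀≡fx₁ → p≢q (trans (sym fx₀≡p) (trans fx₀≡fx₁ fx₁≡q)))
                                                 (↭-length (homType≡⇒↭ f _ type≡)) x
      ... | inj₁ fx≡fx₀ = inj₁ (trans fx≡fx₀ fx₀≡p)
      ... | inj₂ fx≡fx₁ = inj₂ (trans fx≡fx₁ fx₁≡q)

      collapse-Rooted : RootedAt 𝟘 (collapse f) ≡ true
      collapse-Rooted = ∧-true⁺ collapse-Proper (∧-true⁺ (cong (_== 𝟘) (collapse-p f x₀ fx₀≡p))
        (trans (cong InParts fiberSize-collapse)
               (↭⇒InParts _ _ (↭-trans (↭-sym (fiberSizes-two-values f p≢q HomThrough-image x₀ x₁ fx₀≡p fx₁≡q))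
                                       (homType≡⇒↭ f _ type≡)))))
        where
        fiberSize-collapse : fiberSize (collapse f) 𝟘 ≡ fiberSize f p
        fiberSize-collapse = trans (fiberSize≡∑ (collapse f) 𝟘)
          (trans (∑-cong (allFin N) termwise) (sym (fiberSize≡∑ f p)))
          where
          termwise : ∀ x → χ (collapse f x == 𝟘) ≡ χ (f x == p)
          termwise x with f x == p
          ... | true  = refl
          ... | false = refl
        collapse-Proper : Proper (collapse f) ≡ true
        collapse-Proper = Proper-intro (collapse f) (λ u v uv → separated u v (adj-irrefl G (isHom-sound G G f hom u v uv)))
          where
          separated : ∀ u v → f u ≢ f v → collapse f u ≢ collapse f v
          separated u v fu≢fv with HomThrough-image u | HomThrough-image v
          ... | inj₁ fu≡p | inj₁ fv≡p = ⊥-elim (fu≢fv (trans fu≡p (sym fv≡p)))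
          ... | inj₂ fu≡q | inj₂ fv≡q = ⊥-elim (fu≢fv (trans fu≡q (sym fv≡q)))
          ... | inj₁ fu≡p | inj₂ fv≡q = λ same → 𝟘≢𝟙 (trans (sym (collapse-p f u fu≡p)) (trans same (collapse-q f v fv≡q)))
          ... | inj₂ fu≡q | inj₁ fv≡p = λ same → 𝟘≢𝟙 (trans (sym (collapse-p f v fv≡p)) (trans (sym same) (collapse-q f u fu≡q)))

      spread∘collapse : spread (collapse f) ≗ f
      spread∘collapse x with HomThrough-image x
      ... | inj₁ fx≡p = trans (cong onEdge (collapse-p f x fx≡p)) (sym fx≡p)
      ... | inj₂ fx≡q = trans (cong onEdge (collapse-q f x fx≡q)) (sym fx≡q)

    module _ (g : V → Fin 2) (rooted : RootedAt 𝟘 g ≡ true) where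

      private
        proper : Proper g ≡ true
        proper = proj₁ (∧-true⁻ (Proper g) _ rooted)
        x₀↦𝟘∧in-parts : (g x₀ == 𝟘) ∧ InParts (fiberSize g 𝟘) ≡ true
        x₀↦𝟘∧in-parts = proj₂ (∧-true⁻ (Proper g) _ rooted)
        gx₀≡𝟘 : g x₀ ≡ 𝟘
        gx₀≡𝟘 = ==⇒≡ {x = g x₀} {𝟘} (proj₁ (∧-true⁻ _ _ x₀↦𝟘∧in-parts))
        in-parts : InParts (fiberSize g 𝟘) ≡ true
        in-parts = proj₂ (∧-true⁻ (g x₀ == 𝟘) _ x₀↦𝟘∧in-parts)
        gx₁≡𝟙 : g x₁ ≡ 𝟙
        gx₁≡𝟙 with g x₁ in gx₁
        ... | zero       = ⊥-elim (Proper-≢ g proper x₀ x₁ x₀x₁ (trans gx₀≡𝟘 (sym gx₁)))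
        ... | suc zero   = refl

      spread-HomThrough : HomThrough (spread g) ≡ true
      spread-HomThrough = ∧-true⁺ (trans (cong (λ y → onEdge y == q) gx₁≡𝟙) (==-refl q))
        (∧-true⁺ (trans (cong (λ y → onEdge y == p) gx₀≡𝟘) (==-refl p))
        (∧-true⁺ spread-isHom (dec-true (≡-dec _≟_ (homType (spread g)) (twoParts a c)) spread-type)))
        where
        spread-isHom : isHom G G (spread g) ≡ true
        spread-isHom = isHom-complete G G (spread g) (λ u v uv → edge (g u) (g v) (Proper-≢ g proper u v uv))
          where
          edge : ∀ y z → y ≢ z → adj G (onEdge y) (onEdge z) ≡ true
          edge zero       zero       y≢z = ⊥-elim (y≢z refl)
          edge zero       (suc zero) _   = pq
          edge (suc zero) zero       _   = adj-sym p q pq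
          edge (suc zero) (suc zero) y≢z = ⊥-elim (y≢z refl)
        fiberSize-spread : ∀ y → fiberSize (spread g) (onEdge y) ≡ fiberSize g y
        fiberSize-spread y = trans (fiberSize≡∑ (spread g) (onEdge y))
          (trans (∑-cong (allFin N) (λ x → cong χ (onEdge-== (g x) y))) (sym (fiberSize≡∑ g y)))
          where
          onEdge-== : ∀ u y → (onEdge u == onEdge y) ≡ (u == y)
          onEdge-== zero       zero       = ==-refl p
          onEdge-== (suc zero) (suc zero) = ==-refl q
          onEdge-== zero       (suc zero) = ≢⇒==false p≢q
          onEdge-== (suc zero) zero       = ≢⇒==false (p≢q ∘ sym)
        spread-image : ∀ x → spread g x ≡ p ⊎ spread g x ≡ q
        spread-image x with g x
        ... | zero     = inj₁ refl
        ... | suc zero = inj₂ refl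
        spread-type : homType (spread g) ≡ twoParts a c
        spread-type = ↭⇒homType≡ (spread g) _ (twoParts-IsPartition 0<a a≤c)
          (↭-trans (fiberSizes-two-values (spread g) p≢q spread-image x₀ x₁ (cong onEdge gx₀≡𝟘) (cong onEdge gx₁≡𝟙))
                   (subst (_↭ twoParts a c) (cong₂ (λ s t → s ∷ t ∷ []) (sym (fiberSize-spread 𝟘)) (sym (fiberSize-spread 𝟙)))
                          (InParts⇒↭ _ _ (trans (fiberSize-𝟘+𝟙 g) (sym a+c≡N)) in-parts)))

    collapse∘spread : (g : V → Fin 2) → collapse (spread g) ≗ g
    collapse∘spread g x with g x
    ... | zero     rewrite ==-refl p = refl
    ... | suc zero rewrite ≢⇒==false (p≢q ∘ sym) = refl

    #HomThrough≡#Rooted : ∑Maps N N (χ ∘ HomThrough) ≡ #Rooted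
    #HomThrough≡#Rooted = ∑Maps-bijection HomThrough-resp (RootedAt-resp 𝟘) collapse spread
      (λ f g f≗g x → cong (λ y → if y == p then 𝟘 else 𝟙) (f≗g x)) (λ f g f≗g → cong onEdge ∘ f≗g)
      collapse-Rooted spread-HomThrough spread∘collapse (λ g _ → collapse∘spread g)
      where
      HomThrough-resp : Respects≗ HomThrough
      HomThrough-resp f g f≗g = cong₂ _∧_ (cong (_== q) (f≗g x₁)) (cong₂ _∧_ (cong (_== p) (f≗g x₀)) (HomOfType-resp G G (twoParts a c) f g f≗g))

  #HomThrough : V → V → ℕ
  #HomThrough p q = ∑Maps N N (λ f → χ (f x₁ == q) * (χ (f x₀ == p) * χ (OfType f)))

  #HomThrough≡ : ∀ p q → #HomThrough p q ≡ χ (adj G p q) * #Rooted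
  #HomThrough≡ p q = trans (∑-cong (allMaps N N) (λ f → sym (trans (χ-∧ (f x₁ == q) _) (cong (χ (f x₁ == q) *_) (χ-∧ (f x₀ == p) _)))))
                           (by-adj (adj G p q) refl)
    where
    by-adj : ∀ e → adj G p q ≡ e → ∑Maps N N (λ f → χ ((f x₁ == q) ∧ ((f x₀ == p) ∧ OfType f))) ≡ χ e * #Rooted
    by-adj true  pq = trans (Through.#HomThrough≡#Rooted pq) (sym (+-identityʳ #Rooted))
    by-adj false p≁q = ∑-χ-false (allMaps N N) (λ f → not-through f _ refl)
      where
      not-through : ∀ f e → (f x₁ == q) ∧ ((f x₀ == p) ∧ OfType f) ≡ e → e ≡ false
      not-through f false _       = refl
      not-through f true  through with ∧-true⁻ (f x₁ == q) _ through
      ... | x₁↦q , rest with ∧-true⁻ (f x₀ == p) _ rest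
      ...   | x₀↦p , hom∧type = ⊥-elim (false≢true (trans (sym p≁q)
              (subst₂ (λ u v → adj G u v ≡ true) (==⇒≡ {x = f x₀} {p} x₀↦p) (==⇒≡ {x = f x₁} {q} x₁↦q)
                      (isHom-sound G G f (proj₁ (∧-true⁻ _ _ hom∧type)) x₀ x₁ x₀x₁))))

  -- f ↦ (f x₀ , f x₁ , colouring) identifies homomorphisms of type (a, c) with arcs times rooted colourings.
  homCount≡#arcs*#Rooted : homCount G G (twoParts a c) ≡ #arcs G * #Rooted
  homCount≡#arcs*#Rooted = begin
    homCount G G (twoParts a c)
      ≡⟨ homCount≡∑ G G (twoParts a c) ⟩
    ∑Maps N N (χ ∘ OfType)
      ≡⟨ ∑Maps-split (λ f → f x₀) (χ ∘ OfType) ⟩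
    ∑Fin N (λ p → ∑Maps N N (λ f → χ (f x₀ == p) * χ (OfType f)))
      ≡⟨ ∑-cong (allFin N) (λ p → ∑Maps-split (λ f → f x₁) _) ⟩
    ∑Fin N (λ p → ∑Fin N (λ q → #HomThrough p q))
      ≡⟨ ∑-cong (allFin N) (λ p → ∑-cong (allFin N) (#HomThrough≡ p)) ⟩
    ∑Fin N (λ p → ∑Fin N (λ q → χ (adj G p q) * #Rooted))
      ≡⟨ ∑-cong (allFin N) (λ p → ∑-*ʳ (allFin N) #Rooted (λ q → χ (adj G p q))) ⟩
    ∑Fin N (λ p → ∑Fin N (λ q → χ (adj G p q)) * #Rooted)
      ≡⟨ ∑-*ʳ (allFin N) #Rooted _ ⟩
    #arcs G * #Rooted ∎

  #RootedAt𝟙≡#Rooted : ∑Maps N 2 (χ ∘ RootedAt 𝟙) ≡ #Rooted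
  #RootedAt𝟙≡#Rooted = ∑Maps-bijection (RootedAt-resp 𝟙) (RootedAt-resp 𝟘) flipAll flipAll flipAll-resp flipAll-resp
    (flipped 𝟙 𝟘 (λ g → flip-==𝟘 (g x₀))) (flipped 𝟘 𝟙 (λ g → flip-==𝟙 (g x₀)))
    (λ g _ → flipAll-involutive g) (λ g _ → flipAll-involutive g)
    where
    InParts-flipAll : ∀ g → InParts (fiberSize (flipAll g) 𝟘) ≡ InParts (fiberSize g 𝟘)
    InParts-flipAll g = trans (cong InParts (fiberSize-flipAll g))
      (InParts-complement (fiberSize g 𝟙) (fiberSize g 𝟘)
        (trans (+-comm (fiberSize g 𝟙) (fiberSize g 𝟘)) (trans (fiberSize-𝟘+𝟙 g) (sym a+c≡N))))
    flipped : ∀ i j → (∀ g → (flipAll g x₀ == j) ≡ (g x₀ == i)) → ∀ g → RootedAt i g ≡ true → RootedAt j (flipAll g) ≡ true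
    flipped i j root g rooted with ∧-true⁻ (Proper g) _ rooted
    ... | proper , rest with ∧-true⁻ (g x₀ == i) _ rest
    ...   | root-i , in-parts = ∧-true⁺ (flipAll-Proper g proper) (∧-true⁺ (trans (root g) root-i) (trans (InParts-flipAll g) in-parts))

  #Proper-InParts≡2*#Rooted : #Proper InParts ≡ #Rooted + #Rooted
  #Proper-InParts≡2*#Rooted = begin
    #Proper InParts                                                  ≡⟨ ∑-cong (allMaps N 2) by-root ⟩
    ∑Maps N 2 (λ g → χ (RootedAt 𝟘 g) + χ (RootedAt 𝟙 g))           ≡⟨ ∑-+ (allMaps N 2) _ _ ⟩
    #Rooted + ∑Maps N 2 (χ ∘ RootedAt 𝟙)                             ≡⟨ cong (#Rooted +_) #RootedAt𝟙≡#Rooted ⟩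
    #Rooted + #Rooted                                                ∎
    where
    split : ∀ P C → χ (P ∧ C) ≡ χ (P ∧ (true ∧ C)) + χ (P ∧ (false ∧ C))
    split true  C = sym (+-identityʳ _)
    split false C = refl
    by-root : ∀ g → χ (ProperWith InParts g) ≡ χ (RootedAt 𝟘 g) + χ (RootedAt 𝟙 g)
    by-root g with g x₀
    ... | zero     = split (Proper g) (InParts (fiberSize g 𝟘))
    ... | suc zero = trans (split (Proper g) (InParts (fiberSize g 𝟘))) (+-comm (χ (Proper g ∧ InParts (fiberSize g 𝟘))) _)

  homCount-twoParts : homCount G G (twoParts a c) + homCount G G (twoParts a c) ≡ #arcs G * #Proper InParts
  homCount-twoParts = begin
    homCount G G (twoParts a c) + homCount G G (twoParts a c) ≡⟨ cong₂ _+_ homCount≡#arcs*#Rooted homCount≡#arcs*#Rooted ⟩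
    #arcs G * #Rooted + #arcs G * #Rooted                     ≡⟨ *-distribˡ-+ (#arcs G) #Rooted #Rooted ⟨
    #arcs G * (#Rooted + #Rooted)                             ≡⟨ cong (#arcs G *_) #Proper-InParts≡2*#Rooted ⟨
    #arcs G * #Proper InParts                                 ∎

  c≡N∸a : c ≡ N ∸ a
  c≡N∸a = trans (sym (m+n∸m≡n a c)) (cong (_∸ a) a+c≡N)

  #Proper-InParts : #Proper InParts ≡ multiplicity a c * #ProperAt a
  #Proper-InParts with a ≟ c
  ... | yes refl rewrite dec-true (a ≟ a) refl = trans (#Proper-cong≤N _ _ (λ k _ → Boolₚ.∨-idem (does (k ≟ a)))) (sym (+-identityʳ (#ProperAt a)))
  ... | no a≢c rewrite dec-false (a ≟ c) a≢c = begin
    #Proper InParts ≡⟨ #Proper-∨ _ _ (λ k k≡a k≡c → a≢c (trans (sym (does-true⇒ (k ≟ a) k≡a)) (does-true⇒ (k ≟ c) k≡c))) ⟩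
    #ProperAt a + #ProperAt c       ≡⟨ cong (#ProperAt a +_) (trans (cong #ProperAt c≡N∸a) (sym (#ProperAt-palindromic a (subst (a ≤_) a+c≡N (m≤m+n a c))))) ⟩
    #ProperAt a + #ProperAt a       ≡⟨ cong (#ProperAt a +_) (+-identityʳ (#ProperAt a)) ⟨
    2 * #ProperAt a         ∎

  homCount-twoParts-#ProperAt : homCount G G (twoParts a c) + homCount G G (twoParts a c) ≡ multiplicity a c * (#arcs G * #ProperAt a)
  homCount-twoParts-#ProperAt = begin
    homCount G G (twoParts a c) + homCount G G (twoParts a c) ≡⟨ homCount-twoParts ⟩
    #arcs G * #Proper InParts                                 ≡⟨ cong (#arcs G *_) #Proper-InParts ⟩
    #arcs G * (multiplicity a c * #ProperAt a)                        ≡⟨ *-left-comm (#arcs G) (multiplicity a c) (#ProperAt a) ⟩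
    multiplicity a c * (#arcs G * #ProperAt a)                        ∎

-- Coefficients of the self-chromatic symmetric function

XCoeff-fits : (G H : Graph) (λ′ : List ℕ) → length λ′ ≤ n H → XCoeff G H λ′ ≡ homCount G H λ′ * mScale (n H) λ′
XCoeff-fits G H λ′ fits rewrite dec-true (length λ′ ≤? n H) fits = refl

homCount≡0⇒XCoeff≡0 : (G H : Graph) (λ′ : List ℕ) → homCount G H λ′ ≡ 0 → XCoeff G H λ′ ≡ 0
homCount≡0⇒XCoeff≡0 G H λ′ none with length λ′ ≤? n H
... | yes fits = trans (XCoeff-fits G H λ′ fits) (cong (_* mScale (n H) λ′) none)
... | no too-long rewrite dec-false (length λ′ ≤? n H) too-long = refl

mScale-nonZero : (N : ℕ) (λ′ : List ℕ) → NonZero (mScale N λ′)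
mScale-nonZero N λ′ = m*n≢0 _ _ {{product≢0 (factorials (upTo (sum λ′)))}} {{(N ∸ length λ′) !≢0}}
  where
  factorials : (is : List ℕ) → All NonZero (map (λ i → mult λ′ (suc i) !) is)
  factorials []       = []
  factorials (i ∷ is) = (mult λ′ (suc i) !≢0) ∷ factorials is

homCount-positive : (G H : Graph) (f : Fin (n G) → Fin (n H)) → isHom G H f ≡ true → 0 < homCount G H (homType f)
homCount-positive G H f hom = subst (0 <_) (sym (homCount≡∑ G H (homType f)))
  (∑Maps-χ-positive (HomOfType G H (homType f)) (HomOfType-resp G H (homType f)) f (∧-true⁺ hom (dec-true (≡-dec _≟_ (homType f) (homType f)) refl)))

XCoeff-self-positive : (G : Graph) (f : Fin (n G) → Fin (n G)) → isHom G G f ≡ true → XCoeff G G (homType f) ≢ 0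
XCoeff-self-positive G f hom XCoeff≡0 =
  ≢-nonZero⁻¹ _ {{m*n≢0 _ _ {{>-nonZero (homCount-positive G G f hom)}} {{mScale-nonZero (n G) (homType f)}}}}
    (trans (sym (XCoeff-fits G G (homType f) (length-homType f))) XCoeff≡0)

XCoeff≢0⇒hom : (G H : Graph) (λ′ : List ℕ) → XCoeff G H λ′ ≢ 0 →
               ∃[ f ] (isHom G H f ≡ true × homType f ≡ λ′)
XCoeff≢0⇒hom G H λ′ XCoeff≢0 with ∑-χ-nonzero (allMaps (n G) (n H)) (HomOfType G H λ′)
                                     (XCoeff≢0 ∘ homCount≡0⇒XCoeff≡0 G H λ′ ∘ trans (homCount≡∑ G H λ′))
... | f , hom∧type with ∧-true⁻ _ _ hom∧type
...   | hom , type = f , hom , does-true⇒ (≡-dec _≟_ (homType f) λ′) type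

-- The type of the identity has size |V(G)|, and some endomorphism of G′ has that type.
SameSelfChromatic⇒n≡ : (G G′ : Graph) → SameSelfChromatic G G′ → n G ≡ n G′
SameSelfChromatic⇒n≡ G G′ same =
  same-size (XCoeff≢0⇒hom G′ G′ (homType idᴳ) (XCoeff-self-positive G idᴳ (isHom-id G) ∘ trans (same _ (homType-IsPartition idᴳ))))
  where
  idᴳ : Fin (n G) → Fin (n G)
  idᴳ = id
  same-size : ∃[ f′ ] (isHom G′ G′ f′ ≡ true × homType f′ ≡ homType idᴳ) → n G ≡ n G′
  same-size (f′ , _ , type≡) = trans (sym (sum-homType idᴳ)) (trans (cong sum (sym type≡)) (sum-homType f′))

-- Edgeless graphs

Edgeless : Graph → Set
Edgeless G = ∀ u v → adj G u v ≡ false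

HasEdge : Graph → Set
HasEdge G = ∃[ x₀ ] ∃[ x₁ ] adj G x₀ x₁ ≡ true

edge? : (G : Graph) → HasEdge G ⊎ Edgeless G
edge? G with any (λ u → any (adj G u) (allFin (n G))) (allFin (n G)) in some
... | true with any-tabulate⁻ id _ some
...   | u , some-v with any-tabulate⁻ id _ some-v
...     | v , uv = inj₁ (u , v , uv)
edge? G | false = inj₂ (λ u → any-tabulate-false⁻ id _ (any-tabulate-false⁻ id _ some u))

module EdgelessGraph (G : Graph) (edgeless : Edgeless G) (b : Bipartite G) where

  private
    N : ℕ
    N = n G

  reachK-edgeless : ∀ k u v → reachK G k u v ≡ (u == v)
  reachK-edgeless zero    u v = refl
  reachK-edgeless (suc k) u v = begin
    reachK G k u v ∨ any (λ w → reachK G k u w ∧ adj G w v) (allFin N)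
      ≡⟨ cong (reachK G k u v ∨_) (any-false (allFin N) (λ w → trans (cong (reachK G k u w ∧_) (edgeless w v)) (Boolₚ.∧-zeroʳ _))) ⟩
    reachK G k u v ∨ false
      ≡⟨ Boolₚ.∨-identityʳ _ ⟩
    reachK G k u v
      ≡⟨ reachK-edgeless k u v ⟩
    (u == v) ∎

  isRep-edgeless : ∀ v → isRep G v ≡ true
  isRep-edgeless v = cong not (any-false (allFin N) earlier)
    where
    earlier : ∀ u → does (toℕ u <? toℕ v) ∧ connected G u v ≡ false
    earlier u rewrite reachK-edgeless N u v with u Finₚ.≟ v
    ... | yes refl = cong (_∧ true) (dec-false (toℕ u <? toℕ u) (<-irrefl refl))
    ... | no _     = Boolₚ.∧-zeroʳ _

  compDiff-edgeless : ∀ v → compDiff G b v ≡ 1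
  compDiff-edgeless v = trans (cong₂ ∣_-_∣ (count true) (count false)) (differ (proj₁ b v))
    where
    onSide : Bool → Fin N → Bool
    onSide t u = if t then proj₁ b u else not (proj₁ b u)
    count : ∀ t → length (filterᵇ (λ u → connected G v u ∧ onSide t u) (allFin N)) ≡ χ (onSide t v)
    count t = trans (length-filterᵇ _ (allFin N))
      (trans (∑-cong (allFin N) (λ u → trans (cong (λ e → χ (e ∧ onSide t u)) (reachK-edgeless N v u)) (χ-∧ (v == u) _)))
             (∑Fin-selectʳ N v (χ ∘ onSide t)))
    differ : ∀ x → ∣ χ (onSide true v) - χ (onSide false v) ∣ ≡ 1
    differ _ with proj₁ b v
    ... | true  = refl
    ... | false = refl

  nonzeroDiffs-edgeless : nonzeroDiffs G b ≡ tabulate {n = N} (λ _ → 1)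
  nonzeroDiffs-edgeless = begin
    positives (map (compDiff G b) (filterᵇ (isRep G) (allFin N)))
      ≡⟨ cong (positives ∘ map (compDiff G b)) (filterᵇ-all (allFin N)) ⟩
    positives (map (compDiff G b) (allFin N))
      ≡⟨ cong positives (trans (map-tabulate id (compDiff G b)) (tabulate-cong compDiff-edgeless)) ⟩
    positives (tabulate {n = N} (λ _ → 1))
      ≡⟨ filter-all (0 <?_) (tabulate⁺ {n = N} (λ _ → z<s)) ⟩
    tabulate (λ _ → 1) ∎
    where
    filterᵇ-all : (xs : List (Fin N)) → filterᵇ (isRep G) xs ≡ xs
    filterᵇ-all []       = refl
    filterᵇ-all (x ∷ xs) rewrite isRep-edgeless x = cong (x ∷_) (filterᵇ-all xs)

-- A constant map is an endomorphism of type (|V|) of an edgeless graph, but no endomorphism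
-- of a graph with an edge has a single part.
Edgeless-HasEdge-distinguished : (G G′ : Graph) → Edgeless G → HasEdge G′ → SameSelfChromatic G G′ → ⊥
Edgeless-HasEdge-distinguished G G′ edgeless (x₀ , x₁ , x₀x₁) same =
  no-single-part (XCoeff≢0⇒hom G′ G′ (homType const) (XCoeff-self-positive G const const-hom ∘ trans (same _ (homType-IsPartition const))))
  where
  z : Fin (n G)
  z = subst Fin (sym (SameSelfChromatic⇒n≡ G G′ same)) x₀
  const : Fin (n G) → Fin (n G)
  const _ = z
  const-hom : isHom G G const ≡ true
  const-hom = isHom-complete G G const (λ u v uv → ⊥-elim (false≢true (trans (sym (edgeless u v)) uv)))
  no-single-part : ∃[ f′ ] (isHom G′ G′ f′ ≡ true × homType f′ ≡ homType const) → ⊥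
  no-single-part (f′ , f′-hom , type≡) =
    <-irrefl refl (≤-trans (separating⇒two-parts f′ x₀ x₁ (adj-irrefl G′ (isHom-sound G′ G′ f′ f′-hom x₀ x₁ x₀x₁)))
                           (≤-reflexive (sym one-part)))
    where
    one-part : 1 ≡ length (fiberSizes f′)
    one-part = begin
      1                         ≡⟨ cong length (positiveValues-single (fiberSize const) z (λ w w≢ →
                                     fiberSize-outside-image const w (λ _ → w≢ ∘ sym)) (fiberSize-image const z)) ⟨
      length (fiberSizes const) ≡⟨ ↭-length (homType-↭ const) ⟩
      length (homType const)    ≡⟨ cong length type≡ ⟨
      length (homType f′)       ≡⟨ ↭-length (homType-↭ f′) ⟨
      length (fiberSizes f′)    ∎

homCount-twoParts-agree : (G G′ : Graph) → SameSelfChromatic G G′ → n G ≡ n G′ →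
                          ∀ a c → 0 < a → a ≤ c → a + c ≡ n G → homCount G G (twoParts a c) ≡ homCount G′ G′ (twoParts a c)
homCount-twoParts-agree G G′ same N≡N′ a c 0<a a≤c a+c≡N =
  *-cancelʳ-≡ _ _ (mScale (n G) (twoParts a c)) {{mScale-nonZero (n G) (twoParts a c)}} (begin
    homCount G G (twoParts a c) * mScale (n G) (twoParts a c)   ≡⟨ XCoeff-fits G G _ two≤N ⟨
    XCoeff G G (twoParts a c)                                   ≡⟨ same _ (twoParts-IsPartition 0<a a≤c) ⟩
    XCoeff G′ G′ (twoParts a c)                                 ≡⟨ XCoeff-fits G′ G′ _ (subst (2 ≤_) N≡N′ two≤N) ⟩
    homCount G′ G′ (twoParts a c) * mScale (n G′) (twoParts a c) ≡⟨ cong (λ N → homCount G′ G′ (twoParts a c) * mScale N (twoParts a c)) N≡N′ ⟨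
    homCount G′ G′ (twoParts a c) * mScale (n G) (twoParts a c)  ∎)
  where
  two≤N : 2 ≤ n G
  two≤N = subst (2 ≤_) a+c≡N (+-mono-≤ 0<a (<-≤-trans 0<a a≤c))

module WithEdges (G G′ : Graph) (b : Bipartite G) (b′ : Bipartite G′) (same : SameSelfChromatic G G′)
                 {x₀ x₁ : Fin (n G)} (x₀x₁ : adj G x₀ x₁ ≡ true) {y₀ y₁ : Fin (n G′)} (y₀y₁ : adj G′ y₀ y₁ ≡ true) where

  module C  = Colourings G b
  module C′ = Colourings G′ b′

  N : ℕ
  N = n G

  N≡N′ : N ≡ n G′
  N≡N′ = SameSelfChromatic⇒n≡ G G′ same

  E E′ : ℕ
  E  = #arcs G
  E′ = #arcs G′

  instance
    E-nonZero : NonZero E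
    E-nonZero = >-nonZero (#arcs-positive G x₀x₁)
    E′-nonZero : NonZero E′
    E′-nonZero = >-nonZero (#arcs-positive G′ y₀y₁)

  first-half : ∀ a → 0 < a → a + a ≤ N → E * C.#ProperAt a ≡ E′ * C′.#ProperAt a
  first-half a 0<a a+a≤N = *-cancelˡ-≡ _ _ (multiplicity a c) {{multiplicity-nonZero a c}} (begin
    multiplicity a c * (E * C.#ProperAt a)  ≡⟨ T.homCount-twoParts-#ProperAt ⟨
    homCount G G (twoParts a c) + homCount G G (twoParts a c)
      ≡⟨ cong (λ h → h + h) (homCount-twoParts-agree G G′ same N≡N′ a c 0<a a≤c a+c≡N) ⟩
    homCount G′ G′ (twoParts a c) + homCount G′ G′ (twoParts a c) ≡⟨ T′.homCount-twoParts-#ProperAt ⟩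
    multiplicity a c * (E′ * C′.#ProperAt a) ∎)
    where
    c : ℕ
    c = N ∸ a
    a≤c : a ≤ c
    a≤c = m+n≤o⇒m≤o∸n a a+a≤N
    a+c≡N : a + c ≡ N
    a+c≡N = m+[n∸m]≡n (≤-trans (m≤m+n a a) a+a≤N)
    module T  = TwoPartHoms G b x₀x₁ a c 0<a a≤c a+c≡N
    module T′ = TwoPartHoms G′ b′ y₀y₁ a c 0<a a≤c (trans a+c≡N N≡N′)

  scaled-#ProperAt-agree : ∀ s → E * C.#ProperAt s ≡ E′ * C′.#ProperAt s
  scaled-#ProperAt-agree = palindromic-agree N (λ s → E * C.#ProperAt s) (λ s → E′ * C′.#ProperAt s)
    (λ s N<s → both-zero (C.#ProperAt-beyond s N<s) (C′.#ProperAt-beyond s (subst (_< s) N≡N′ N<s)))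
    (both-zero (C.#ProperAt-0 x₀x₁) (C′.#ProperAt-0 y₀y₁))
    (λ s s≤N → cong (E *_) (C.#ProperAt-palindromic s s≤N))
    (λ s s≤N → cong (E′ *_) (palindromic′ s s≤N))
    first-half
    where
    both-zero : ∀ {u u′} → u ≡ 0 → u′ ≡ 0 → E * u ≡ E′ * u′
    both-zero refl refl = trans (*-zeroʳ E) (sym (*-zeroʳ E′))
    palindromic′ : ∀ s → s ≤ N → C′.#ProperAt s ≡ C′.#ProperAt (N ∸ s)
    palindromic′ s s≤N = trans (C′.#ProperAt-palindromic s (subst (s ≤_) N≡N′ s≤N))
                               (cong (λ N → C′.#ProperAt (N ∸ s)) (sym N≡N′))

  nonzeroDiffs-↭ : nonzeroDiffs G b ↭ nonzeroDiffs G′ b′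
  nonzeroDiffs-↭ = subst₂ _↭_ (sym C.nonzeroDiffs≡positive-gaps) (sym C′.nonzeroDiffs≡positive-gaps)
    (positive-gaps-determined C.sidePairs C′.sidePairs E E′ scaled-choiceCounts-agree)
    where
    scaled-choiceCounts-agree : ∀ s → E * choiceCountAt C.sidePairs s ≡ E′ * choiceCountAt C′.sidePairs s
    scaled-choiceCounts-agree s = begin
      E * choiceCountAt C.sidePairs s    ≡⟨ cong (E *_) (C.#ProperAt≡choiceCountAt s) ⟨
      E * C.#ProperAt s                  ≡⟨ scaled-#ProperAt-agree s ⟩
      E′ * C′.#ProperAt s                ≡⟨ cong (E′ *_) (C′.#ProperAt≡choiceCountAt s) ⟩
      E′ * choiceCountAt C′.sidePairs s  ∎

proposition2p5 : (G G′ : Graph) (b : Bipartite G) (b′ : Bipartite G′) →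
    SameSelfChromatic G G′ → nonzeroDiffs G b ↭ nonzeroDiffs G′ b′
proposition2p5 G G′ b b′ same with edge? G | edge? G′
... | inj₁ (_ , _ , x₀x₁) | inj₁ (_ , _ , y₀y₁) = WithEdges.nonzeroDiffs-↭ G G′ b b′ same x₀x₁ y₀y₁
... | inj₂ edgeless | inj₂ edgeless′ = ↭-reflexive (begin
  nonzeroDiffs G b               ≡⟨ EdgelessGraph.nonzeroDiffs-edgeless G edgeless b ⟩
  tabulate {n = n G} (λ _ → 1)   ≡⟨ cong (λ N → tabulate {n = N} (λ _ → 1)) (SameSelfChromatic⇒n≡ G G′ same) ⟩
  tabulate {n = n G′} (λ _ → 1)  ≡⟨ EdgelessGraph.nonzeroDiffs-edgeless G′ edgeless′ b′ ⟨
  nonzeroDiffs G′ b′             ∎)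
... | inj₂ edgeless | inj₁ edge′ = ⊥-elim (Edgeless-HasEdge-distinguished G G′ edgeless edge′ same)
... | inj₁ edge | inj₂ edgeless′ = ⊥-elim (Edgeless-HasEdge-distinguished G′ G edgeless′ edge (λ λ′ part → sym (same λ′ part)))
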